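{- Let $\mathbf{b}=(b_1,\dots,b_d)\in\mathbb{Z}_{>0}^d$ be such that $\sum_{i=1}^d b_i$ is even, and let $P_{\mathbf{b}}$ and the notation $(S,k)$ be as in the context. Then: (1) $(\emptyset,d+2)$ and $([d+1],d+2)$ are vertices of $P_{\mathbf{b}}$; (2) the distance between $(\emptyset,d+2)$ and $([d+1],d+2)$ in the graph of $P_{\mathbf{b}}$ is at most $d+1$ if and only if there exists $S\subseteq[d]$ with $\sum_{i\in S}b_i=\sum_{j\in[d]\setminus S}b_j$.
   Context: Let $\beta=\frac12\sum_{i=1}^d b_i$, $\mathbf{w}=(b_1,\dots,b_d,-\beta,\beta+\frac12)\in\mathbb{R}^{d+2}$, and $P_{\mathbf{b}}=[0,1]^{d+2}\cap\{\mathbf{x}\in\mathbb{R}^{d+2}:\mathbf{w}^\intercal\mathbf{x}\le\beta+\frac14\}$. For $S\subseteq[d+2]$ let $\mathbf{e}_S=\sum_{i\in S}\mathbf{e}_i$, and for $k\in[d+2]\setminus S$ let $(S,k)$ denote the point $\mathbf{e}_S+\frac{\beta+\frac14-\sum_{i\in S}w_i}{w_k}\mathbf{e}_k$. The graph of a polytope is its vertex–edge graph.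
   Formalization: The polytope $P_{\mathbf{b}}$, its vertices and edges, and the linear functionals exposing them are taken in ℚ^(d+2) instead of $\mathbb{R}^{d+2}$. -}

module Defs where

open import Data.Nat as ℕ using (ℕ; zero; suc)
open import Data.Integer using (+_)
open import Data.Rational using (ℚ; 0ℚ; 1ℚ; _+_; _-_; _*_; -_; _÷_; _/_; _≤_; _<_; ≢-nonZero)
open import Data.Rational.Properties using (_≟_)
open import Data.Fin as Fin using (Fin; toℕ; fromℕ<)
open import Data.Fin.Subset using (Subset)
open import Data.Vec using (lookup; tabulate)
open import Data.Bool using (Bool; true; false; if_then_else_)
open import Data.Product using (_×_; Σ; ∃; _,_)
open import Relation.Nullary using (¬_; yes; no; does)
open import Relation.Binary.PropositionalEquality using (_≡_)

sumℚ : ∀ {m} → (Fin m → ℚ) → ℚ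
sumℚ {zero}  f = 0ℚ
sumℚ {suc m} f = f Fin.zero + sumℚ (λ i → f (Fin.suc i))

sumℕ : ∀ {m} → (Fin m → ℕ) → ℕ
sumℕ {zero}  f = 0
sumℕ {suc m} f = f Fin.zero ℕ.+ sumℕ (λ i → f (Fin.suc i))

Vecℚ : ℕ → Set
Vecℚ m = Fin m → ℚ

dot : ∀ {m} → Vecℚ m → Vecℚ m → ℚ
dot x y = sumℚ (λ i → x i * y i)

_≐_ : ∀ {m} → Vecℚ m → Vecℚ m → Set
x ≐ y = ∀ i → x i ≡ y i

-- Division, total (returns 0 when dividing by 0; only used with nonzero divisor)
_÷′_ : ℚ → ℚ → ℚ
p ÷′ q with q ≟ 0ℚ
... | yes _  = 0ℚ
... | no q≢0 = _÷_ p q {{≢-nonZero q≢0}}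

-- Ambient dimension d+2, coordinates indexed by Fin (suc (suc d)):
-- index i (0-based) corresponds to coordinate i+1 of the paper.
-- β = (1/2) Σ b_i
β : ∀ {d} → (Fin d → ℕ) → ℚ
β b = + sumℕ b / 2

½ ¼ : ℚ
½ = + 1 / 2
¼ = + 1 / 4

w : ∀ {d} → (Fin d → ℕ) → Vecℚ (suc (suc d))
w {d} b i with toℕ i ℕ.<? d
... | yes p = + b (fromℕ< p) / 1
... | no _ with toℕ i ℕ.≟ d
...   | yes _ = - β b
...   | no _  = β b + ½

InP : ∀ {d} → (Fin d → ℕ) → Vecℚ (suc (suc d)) → Set
InP b x = (∀ i → (0ℚ ≤ x i) × (x i ≤ 1ℚ)) × (dot (w b) x ≤ β b + ¼)

eS : ∀ {m} → Subset m → Vecℚ m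
eS S i = if lookup S i then 1ℚ else 0ℚ

-- the point (S,k) = e_S + ((β + 1/4 − Σ_{i∈S} w_i) / w_k) e_k   (for k ∉ S)
pt : ∀ {d} → (Fin d → ℕ) → Subset (suc (suc d)) → Fin (suc (suc d)) → Vecℚ (suc (suc d))
pt b S k i =
  if does (i Fin.≟ k)
  then ((β b + ¼ - dot (w b) (eS S)) ÷′ w b k)
  else eS S i

IsVertex : ∀ {d} → (Fin d → ℕ) → Vecℚ (suc (suc d)) → Set
IsVertex {d} b x =
  InP b x ×
  Σ (Vecℚ (suc (suc d))) (λ c → ∀ y → InP b y → ¬ (y ≐ x) → dot c y < dot c x)

OnSegment : ∀ {m} → Vecℚ m → Vecℚ m → Vecℚ m → Set
OnSegment u v y = Σ ℚ (λ t → (0ℚ ≤ t) × (t ≤ 1ℚ) × (∀ i → y i ≡ u i + t * (v i - u i)))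

IsEdge : ∀ {d} → (Fin d → ℕ) → Vecℚ (suc (suc d)) → Vecℚ (suc (suc d)) → Set
IsEdge {d} b u v =
  InP b u × InP b v × ¬ (u ≐ v) ×
  Σ (Vecℚ (suc (suc d))) (λ c →
      (∀ y → InP b y → dot c y ≤ dot c u) ×
      (dot c v ≡ dot c u) ×
      (∀ y → InP b y → dot c y ≡ dot c u → OnSegment u v y))

data Walk {d : ℕ} (b : Fin d → ℕ) : Vecℚ (suc (suc d)) → Vecℚ (suc (suc d)) → ℕ → Set where
  here : ∀ {x} → Walk b x x 0
  step : ∀ {x y z k} → IsEdge b x y → Walk b y z k → Walk b x z (suc k)

DistLe : ∀ {d} → (Fin d → ℕ) → Vecℚ (suc (suc d)) → Vecℚ (suc (suc d)) → ℕ → Set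
DistLe b x y n = ∃ (λ k → (k ℕ.≤ n) × Walk b x y k)

∅S : ∀ {m} → Subset m
∅S = tabulate (λ _ → false)

firstS : ∀ d → Subset (suc (suc d))
firstS d = tabulate (λ i → toℕ i ℕ.<ᵇ suc d)

lastI : ∀ d → Fin (suc (suc d))
lastI d = Fin.fromℕ (suc d)

sumIn sumOut : ∀ {d} → (Fin d → ℕ) → Subset d → ℕ
sumIn  b S = sumℕ (λ i → if lookup S i then b i else 0)
sumOut b S = sumℕ (λ i → if lookup S i then 0 else b i)

-- The hyperplane w·x = β + ¼ contains no 0/1 point, since w·x is a multiple of ½ there.
-- Hence for every 0/1 mask S with 0 ≤ Σ_{S} w ≤ β the point (S, d+2) is a vertex, and adding
-- one coordinate to S gives an edge; both are certified by the functional w tilted by ±1 on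
-- the coordinates that stay fixed.
--
-- If S splits b evenly, inserting the items of S, then coordinate d+1 (weight -β, bringing
-- Σ_{S} w back to 0), then the remaining items walks from (∅, d+2) to ([d+1], d+2) in d+1 steps.
--
-- Conversely, a point of an edge can only be perturbed inside P_b along the edge. Perturbing
-- the midpoint of an edge shows that an edge raises at most one coordinate other than d+2 to 1,
-- and that an edge leaving (S, d+2) while raising coordinate l ends at (S ∪ {l}, d+2). A walk of
-- length d+1 from (∅, d+2) to ([d+1], d+2) must raise one coordinate per step, so it passes
-- through points (S, d+2) and (S ∪ {d+1}, d+2). Both have last coordinate strictly between 0 and
-- 1, which squeezes Σ_{S} b within ¼ of β; hence Σ_{S} b = β.

module Submission where

open import Defs
open import Data.Bool using (Bool; true; false; if_then_else_; not; _∧_; _∨_; T)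
open import Data.Bool.Properties using (∨-identityʳ; ∨-zeroʳ; T-≡)
open import Data.Empty using (⊥; ⊥-elim)
open import Data.Fin as Fin using (Fin; toℕ; fromℕ<)
open import Data.Fin.Properties
  using (0≢1+n; suc-injective; any?; toℕ-injective; toℕ<n; toℕ-fromℕ; toℕ-fromℕ<; toℕ-inject₁)
open import Data.Fin.Subset using (Subset)
import Data.Integer as ℤ
import Data.Integer.Tactic.RingSolver as ℤ-Solver
open import Data.Maybe using (Maybe; just; nothing)
open import Data.Nat as ℕ using (ℕ; zero; suc)
open import Data.Nat.Divisibility using (_∣_)
import Data.Nat.Properties as ℕₚ
open import Data.Product using (_×_; _,_; Σ; ∃; proj₁; proj₂)
open import Data.Rational
  using (ℚ; 0ℚ; 1ℚ; _+_; _-_; _*_; -_; _/_; _≤_; _<_; ∣_∣; _⊓_; 1/_; toℚᵘ; positive; nonNegative; ≢-nonZero)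
open import Data.Rational.Properties
import Data.Rational.Unnormalised as ℚᵘ
import Data.Rational.Unnormalised.Properties as ℚᵘₚ
open import Data.Sum using (_⊎_; inj₁; inj₂)
open import Data.Unit using (⊤; tt)
open import Data.Vec using (lookup; tabulate; []; _∷_)
open import Data.Vec.Properties using (lookup∘tabulate; tabulate-cong)
open import Function using (_∘′_)
open import Function.Bundles using (Equivalence; _⇔_; mk⇔)
open import Level using (0ℓ)
open import Relation.Binary.Definitions using (tri<; tri≈; tri>)
open import Relation.Binary.PropositionalEquality
open import Relation.Nullary using (¬_; Dec; yes; no; does)
open import Relation.Nullary.Decidable using (_×-dec_; _⊎-dec_; ¬?)
open import Tactic.RingSolver using (solve-∀)
import Tactic.RingSolver.Core.AlmostCommutativeRing as ACR

ringℚ : ACR.AlmostCommutativeRing 0ℓ 0ℓ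
ringℚ = ACR.fromCommutativeRing +-*-commutativeRing isZero
  where
  isZero : (x : ℚ) → Maybe (0ℚ ≡ x)
  isZero x with 0ℚ ≟ x
  ... | yes e = just e
  ... | no _  = nothing

0≤-diff : ∀ {p q} → p ≤ q → 0ℚ ≤ q - p
0≤-diff {p} {q} p≤q = subst (_≤ q - p) (+-inverseʳ p) (+-monoˡ-≤ (- p) p≤q)

0<-diff : ∀ {p q} → p < q → 0ℚ < q - p
0<-diff {p} {q} p<q = subst (_< q - p) (+-inverseʳ p) (+-monoˡ-< (- p) p<q)

≤-from-diff : ∀ {p q} e → 0ℚ ≤ e → q - p ≡ e → p ≤ q
≤-from-diff {p} {q} e 0≤e q-p≡e =
  subst₂ _≤_ (+-identityˡ p) (eq q p) (+-monoˡ-≤ p (subst (0ℚ ≤_) (sym q-p≡e) 0≤e))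
  where eq : ∀ q p → q - p + p ≡ q
        eq = solve-∀ ringℚ

<-from-diff : ∀ {p q} e → 0ℚ < e → q - p ≡ e → p < q
<-from-diff {p} {q} e 0<e q-p≡e =
  subst₂ _<_ (+-identityˡ p) (eq q p) (+-monoˡ-< p (subst (0ℚ <_) (sym q-p≡e) 0<e))
  where eq : ∀ q p → q - p + p ≡ q
        eq = solve-∀ ringℚ

0≤+ : ∀ {p q} → 0ℚ ≤ p → 0ℚ ≤ q → 0ℚ ≤ p + q
0≤+ = +-mono-≤

0<+ : ∀ {p q} → 0ℚ < p → 0ℚ ≤ q → 0ℚ < p + q
0<+ = +-mono-<-≤

0≤* : ∀ {p q} → 0ℚ ≤ p → 0ℚ ≤ q → 0ℚ ≤ p * q
0≤* {p} {q} 0≤p 0≤q = subst (_≤ p * q) (*-zeroʳ p) (*-monoˡ-≤-nonNeg p {{nonNegative 0≤p}} 0≤q)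

0<* : ∀ {p q} → 0ℚ < p → 0ℚ < q → 0ℚ < p * q
0<* {p} {q} 0<p 0<q = subst (_< p * q) (*-zeroʳ p) (*-monoʳ-<-pos p {{positive 0<p}} 0<q)

0<1 : 0ℚ < 1ℚ
0<1 = positive⁻¹ 1ℚ

0<½ : 0ℚ < ½
0<½ = positive⁻¹ ½

0<¼ : 0ℚ < ¼
0<¼ = positive⁻¹ ¼

p-q≡0⇒p≡q : ∀ {p q} → p - q ≡ 0ℚ → p ≡ q
p-q≡0⇒p≡q {p} {q} p-q≡0 = trans (eq p q) (trans (cong (_+ q) p-q≡0) (+-identityˡ q))
  where eq : ∀ p q → p ≡ (p - q) + q
        eq = solve-∀ ringℚ

x+a+c≡r⇒x≡r-a-c : ∀ {x a c r} → x + a + c ≡ r → x ≡ r - a - c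
x+a+c≡r⇒x≡r-a-c {x} {a} {c} refl = eq x a c
  where eq : ∀ x a c → x ≡ x + a + c - a - c
        eq = solve-∀ ringℚ

p*q≡0⇒p≡0∨q≡0 : ∀ p q → p * q ≡ 0ℚ → p ≡ 0ℚ ⊎ q ≡ 0ℚ
p*q≡0⇒p≡0∨q≡0 p q pq≡0 with p ≟ 0ℚ
... | yes p≡0 = inj₁ p≡0
... | no p≢0 = inj₂ (begin
  q                ≡⟨ sym (*-identityˡ q) ⟩
  1ℚ * q           ≡⟨ cong (_* q) (sym (*-inverseˡ p)) ⟩
  1/ p * p * q     ≡⟨ *-assoc (1/ p) p q ⟩
  1/ p * (p * q)   ≡⟨ cong (1/ p *_) pq≡0 ⟩
  1/ p * 0ℚ        ≡⟨ *-zeroʳ (1/ p) ⟩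
  0ℚ               ∎)
  where
  open ≡-Reasoning
  instance _ = ≢-nonZero p≢0

*≢0 : ∀ {p q} → p ≢ 0ℚ → q ≢ 0ℚ → p * q ≢ 0ℚ
*≢0 {p} {q} p≢0 q≢0 pq≡0 with p*q≡0⇒p≡0∨q≡0 p q pq≡0
... | inj₁ p≡0 = p≢0 p≡0
... | inj₂ q≡0 = q≢0 q≡0

p÷′q*q≡p : ∀ p q → q ≢ 0ℚ → (p ÷′ q) * q ≡ p
p÷′q*q≡p p q q≢0 with q ≟ 0ℚ
... | yes q≡0 = ⊥-elim (q≢0 q≡0)
... | no q≢0′ = begin
  p * 1/ q * q     ≡⟨ *-assoc p (1/ q) q ⟩
  p * (1/ q * q)   ≡⟨ cong (p *_) (*-inverseˡ q) ⟩
  p * 1ℚ           ≡⟨ *-identityʳ p ⟩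
  p                ∎
  where
  open ≡-Reasoning
  instance _ = ≢-nonZero q≢0′

≤∧≢⇒< : ∀ {p q} → p ≤ q → p ≢ q → p < q
≤∧≢⇒< {p} {q} p≤q p≢q with <-cmp p q
... | tri< p<q _ _ = p<q
... | tri≈ _ p≡q _ = ⊥-elim (p≢q p≡q)
... | tri> _ _ q<p = ⊥-elim (<-irrefl refl (<-≤-trans q<p p≤q))

≤⇒<∨≡ : ∀ {p q} → p ≤ q → p < q ⊎ p ≡ q
≤⇒<∨≡ {p} {q} p≤q with p ≟ q
... | yes p≡q = inj₂ p≡q
... | no p≢q = inj₁ (≤∧≢⇒< p≤q p≢q)

x+x≡y+y⇒x≡y : ∀ {x y} → x + x ≡ y + y → x ≡ y
x+x≡y+y⇒x≡y {x} {y} x+x≡y+y = trans (eq x) (trans (cong (½ *_) x+x≡y+y) (sym (eq y)))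
  where eq : ∀ x → x ≡ ½ * (x + x)
        eq = solve-∀ ringℚ

p≤∣p∣ : ∀ p → p ≤ ∣ p ∣
p≤∣p∣ p with ∣p∣≡p∨∣p∣≡-p p
... | inj₁ ∣p∣≡p  = ≤-reflexive (sym ∣p∣≡p)
... | inj₂ ∣p∣≡-p = ≤-from-diff (∣ p ∣ + ∣ p ∣) (0≤+ (0≤∣p∣ p) (0≤∣p∣ p)) (eq ∣p∣≡-p)
  where eq : ∀ {x} → x ≡ - p → x - p ≡ x + x
        eq refl = refl

-p≤∣p∣ : ∀ p → - p ≤ ∣ p ∣
-p≤∣p∣ p = subst (- p ≤_) (∣-p∣≡∣p∣ p) (p≤∣p∣ (- p))

0<⊓ : ∀ {p q} → 0ℚ < p → 0ℚ < q → 0ℚ < p ⊓ q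
0<⊓ {p} {q} 0<p 0<q with ⊓-sel p q
... | inj₁ p⊓q≡p = subst (0ℚ <_) (sym p⊓q≡p) 0<p
... | inj₂ p⊓q≡q = subst (0ℚ <_) (sym p⊓q≡q) 0<q

Fractional : ℚ → Set
Fractional q = (0ℚ < q) × (q < 1ℚ)

fractional? : ∀ q → Dec (Fractional q)
fractional? q = (0ℚ <? q) ×-dec (q <? 1ℚ)

unit-interval-cases : ∀ {q} → 0ℚ ≤ q → q ≤ 1ℚ → q ≡ 0ℚ ⊎ q ≡ 1ℚ ⊎ Fractional q
unit-interval-cases {q} 0≤q q≤1 with q ≟ 0ℚ | q ≟ 1ℚ
... | yes q≡0 | _       = inj₁ q≡0
... | no _    | yes q≡1 = inj₂ (inj₁ q≡1)
... | no q≢0  | no q≢1  = inj₂ (inj₂ (≤∧≢⇒< 0≤q (q≢0 ∘′ sym) , ≤∧≢⇒< q≤1 q≢1))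

mid : ℚ → ℚ → ℚ
mid a b = a + ½ * (b - a)

mid-fractional : ∀ {a b} → 0ℚ ≤ a → a ≤ 1ℚ → 0ℚ ≤ b → b ≤ 1ℚ →
                 0ℚ < a ⊎ 0ℚ < b → a < 1ℚ ⊎ b < 1ℚ → Fractional (mid a b)
mid-fractional {a} {b} 0≤a a≤1 0≤b b≤1 0<a∨0<b a<1∨b<1 = above 0<a∨0<b , below a<1∨b<1
  where
  eq₀ : ∀ a b → (a + ½ * (b - a)) - 0ℚ ≡ ½ * a + ½ * b
  eq₀ = solve-∀ ringℚ
  eq₁ : ∀ a b → 1ℚ - (a + ½ * (b - a)) ≡ ½ * (1ℚ - a) + ½ * (1ℚ - b)
  eq₁ = solve-∀ ringℚ
  above : 0ℚ < a ⊎ 0ℚ < b → 0ℚ < mid a b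
  above (inj₁ 0<a) = <-from-diff _ (0<+ (0<* 0<½ 0<a) (0≤* (<⇒≤ 0<½) 0≤b)) (eq₀ a b)
  above (inj₂ 0<b) = <-from-diff _ (subst (0ℚ <_) (+-comm (½ * b) (½ * a))
                       (0<+ (0<* 0<½ 0<b) (0≤* (<⇒≤ 0<½) 0≤a))) (eq₀ a b)
  below : a < 1ℚ ⊎ b < 1ℚ → mid a b < 1ℚ
  below (inj₁ a<1) = <-from-diff _ (0<+ (0<* 0<½ (0<-diff a<1)) (0≤* (<⇒≤ 0<½) (0≤-diff b≤1))) (eq₁ a b)
  below (inj₂ b<1) = <-from-diff _ (subst (0ℚ <_) (+-comm (½ * (1ℚ - b)) (½ * (1ℚ - a)))
                       (0<+ (0<* 0<½ (0<-diff b<1)) (0≤* (<⇒≤ 0<½) (0≤-diff a≤1)))) (eq₁ a b)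

mid-cases : ∀ {a b} → 0ℚ ≤ a → a ≤ 1ℚ → 0ℚ ≤ b → b ≤ 1ℚ →
            (a ≡ 0ℚ × b ≡ 0ℚ) ⊎ (a ≡ 1ℚ × b ≡ 1ℚ) ⊎ Fractional (mid a b)
mid-cases {a} {b} 0≤a a≤1 0≤b b≤1 with unit-interval-cases 0≤a a≤1 | unit-interval-cases 0≤b b≤1
... | inj₁ a≡0               | inj₁ b≡0               = inj₁ (a≡0 , b≡0)
... | inj₂ (inj₁ a≡1)        | inj₂ (inj₁ b≡1)        = inj₂ (inj₁ (a≡1 , b≡1))
... | inj₁ a≡0               | inj₂ (inj₁ b≡1)        =
  inj₂ (inj₂ (fractional (inj₂ (subst (0ℚ <_) (sym b≡1) 0<1)) (inj₁ (subst (_< 1ℚ) (sym a≡0) 0<1))))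
  where fractional = mid-fractional 0≤a a≤1 0≤b b≤1
... | inj₂ (inj₁ a≡1)        | inj₁ b≡0               =
  inj₂ (inj₂ (fractional (inj₁ (subst (0ℚ <_) (sym a≡1) 0<1)) (inj₂ (subst (_< 1ℚ) (sym b≡0) 0<1))))
  where fractional = mid-fractional 0≤a a≤1 0≤b b≤1
... | inj₂ (inj₂ (0<a , a<1)) | _                     = inj₂ (inj₂ (mid-fractional 0≤a a≤1 0≤b b≤1 (inj₁ 0<a) (inj₁ a<1)))
... | inj₁ _                 | inj₂ (inj₂ (0<b , b<1)) = inj₂ (inj₂ (mid-fractional 0≤a a≤1 0≤b b≤1 (inj₂ 0<b) (inj₂ b<1)))
... | inj₂ (inj₁ _)          | inj₂ (inj₂ (0<b , b<1)) = inj₂ (inj₂ (mid-fractional 0≤a a≤1 0≤b b≤1 (inj₂ 0<b) (inj₂ b<1)))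

mid≡⇒≡ : ∀ {a b r} → a ≤ r → b ≤ r → mid a b ≡ r → b ≡ r
mid≡⇒≡ {a} {b} a≤r b≤r refl = ≤-antisym b≤r (≤-from-diff _ (0≤-diff a≤r) (eq a b))
  where eq : ∀ a b → b - (a + ½ * (b - a)) ≡ (a + ½ * (b - a)) - a
        eq = solve-∀ ringℚ

mid<⇒< : ∀ {a b r} → a ≡ r → mid a b < r → b < r
mid<⇒< {a} {b} refl m<a = <-from-diff _ (0<+ (0<-diff m<a) (<⇒≤ (0<-diff m<a))) (eq a b)
  where eq : ∀ a b → a - b ≡ (a - (a + ½ * (b - a))) + (a - (a + ½ * (b - a)))
        eq = solve-∀ ringℚ

ι : ℕ → ℚ
ι n = ℤ.+ n / 1

ι≃ : ∀ n → toℚᵘ (ι n) ℚᵘ.≃ ℚᵘ.mkℚᵘ (ℤ.+ n) 0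
ι≃ n = toℚᵘ-fromℚᵘ (ℚᵘ.mkℚᵘ (ℤ.+ n) 0)

-- Normalising ℤ.+ n / 1 does not compute for a variable n, so this goes through ℚᵘ.
ι-suc : ∀ n → ι (suc n) ≡ 1ℚ + ι n
ι-suc n = toℚᵘ-injective (ℚᵘₚ.≃-trans (ι≃ (suc n)) (ℚᵘₚ.≃-trans unnormalised (ℚᵘₚ.≃-sym
  (ℚᵘₚ.≃-trans (toℚᵘ-homo-+ 1ℚ (ι n)) (ℚᵘₚ.+-cong (ℚᵘₚ.≃-refl {toℚᵘ 1ℚ}) (ι≃ n))))))
  where
  eq : ∀ x → (ℤ.+ 1 ℤ.+ x) ℤ.* ℤ.+ 1 ≡ (ℤ.+ 1 ℤ.* ℤ.+ 1 ℤ.+ x ℤ.* ℤ.+ 1) ℤ.* ℤ.+ 1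
  eq = ℤ-Solver.solve-∀
  unnormalised : ℚᵘ.mkℚᵘ (ℤ.+ suc n) 0 ℚᵘ.≃ (ℚᵘ.mkℚᵘ (ℤ.+ 1) 0 ℚᵘ.+ ℚᵘ.mkℚᵘ (ℤ.+ n) 0)
  unnormalised = ℚᵘ.*≡* (eq (ℤ.+ n))

ι-+ : ∀ m n → ι (m ℕ.+ n) ≡ ι m + ι n
ι-+ zero    n = sym (+-identityˡ (ι n))
ι-+ (suc m) n = begin
  ι (suc (m ℕ.+ n))   ≡⟨ ι-suc (m ℕ.+ n) ⟩
  1ℚ + ι (m ℕ.+ n)    ≡⟨ cong (1ℚ +_) (ι-+ m n) ⟩
  1ℚ + (ι m + ι n)    ≡⟨ sym (+-assoc 1ℚ (ι m) (ι n)) ⟩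
  1ℚ + ι m + ι n      ≡⟨ cong (_+ ι n) (sym (ι-suc m)) ⟩
  ι (suc m) + ι n     ∎
  where open ≡-Reasoning

0≤ι : ∀ n → 0ℚ ≤ ι n
0≤ι zero    = ≤-refl
0≤ι (suc n) = subst (0ℚ ≤_) (sym (ι-suc n)) (0≤+ (<⇒≤ 0<1) (0≤ι n))

0<ι : ∀ {n} → 0 ℕ.< n → 0ℚ < ι n
0<ι {suc n} _ = subst (0ℚ <_) (sym (ι-suc n)) (0<+ 0<1 (0≤ι n))

ι-mono : ∀ {m n} → m ℕ.≤ n → ι m ≤ ι n
ι-mono {m} {n} m≤n = subst (λ k → ι m ≤ ι k) (ℕₚ.m+[n∸m]≡n m≤n)
  (subst (ι m ≤_) (sym (ι-+ m (n ℕ.∸ m))) (≤-from-diff _ (0≤ι (n ℕ.∸ m)) (eq (ι m) (ι (n ℕ.∸ m)))))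
  where eq : ∀ a c → (a + c) - a ≡ c
        eq = solve-∀ ringℚ

ι-sum : ∀ {m} (f : Fin m → ℕ) → sumℚ (λ j → ι (f j)) ≡ ι (sumℕ f)
ι-sum {zero}  f = refl
ι-sum {suc m} f = trans (cong (ι (f Fin.zero) +_) (ι-sum (f ∘′ Fin.suc))) (sym (ι-+ (f Fin.zero) _))

ι+½<ι-suc : ∀ c → ι c + ½ < ι (suc c)
ι+½<ι-suc c = <-from-diff ½ 0<½ (trans (cong (_- (ι c + ½)) (ι-suc c)) (eq (ι c)))
  where eq : ∀ x → 1ℚ + x - (x + ½) ≡ ½
        eq = solve-∀ ringℚ

ι<ι+½⇒≤ : ∀ {a c} → ι a < ι c + ½ → a ℕ.≤ c
ι<ι+½⇒≤ {a} {c} ιa<ιc+½ with a ℕ.≤? c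
... | yes a≤c = a≤c
... | no a≰c  = ⊥-elim (<-irrefl refl (<-≤-trans ιa<ιc+½ (≤-trans (<⇒≤ (ι+½<ι-suc c)) (ι-mono (ℕₚ.≰⇒> a≰c)))))

ι≢ι+½ : ∀ a c → ι a ≢ ι c + ½
ι≢ι+½ a c ιa≡ιc+½ with a ℕ.≤? c
... | yes a≤c = <-irrefl refl (≤-<-trans (ι-mono a≤c) (subst (ι c <_) (sym ιa≡ιc+½) ιc<ιc+½))
  where ιc<ιc+½ = <-from-diff ½ 0<½ (eq (ι c))
          where eq : ∀ x → x + ½ - x ≡ ½
                eq = solve-∀ ringℚ
... | no a≰c  = <-irrefl refl (≤-<-trans (ι-mono (ℕₚ.≰⇒> a≰c)) (subst (_< ι (suc c)) (sym ιa≡ιc+½) (ι+½<ι-suc c)))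

s+s≡ι : ∀ s → (ℤ.+ s / 2) + (ℤ.+ s / 2) ≡ ι s
s+s≡ι s = toℚᵘ-injective (ℚᵘₚ.≃-trans (toℚᵘ-homo-+ h h)
  (ℚᵘₚ.≃-trans (ℚᵘₚ.+-cong h≃ h≃) (ℚᵘₚ.≃-trans unnormalised (ℚᵘₚ.≃-sym (ι≃ s)))))
  where
  h = ℤ.+ s / 2
  h≃ : toℚᵘ h ℚᵘ.≃ ℚᵘ.mkℚᵘ (ℤ.+ s) 1
  h≃ = toℚᵘ-fromℚᵘ (ℚᵘ.mkℚᵘ (ℤ.+ s) 1)
  eq : ∀ x → (x ℤ.* ℤ.+ 2 ℤ.+ x ℤ.* ℤ.+ 2) ℤ.* ℤ.+ 1 ≡ x ℤ.* ℤ.+ 4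
  eq = ℤ-Solver.solve-∀
  unnormalised : (ℚᵘ.mkℚᵘ (ℤ.+ s) 1 ℚᵘ.+ ℚᵘ.mkℚᵘ (ℤ.+ s) 1) ℚᵘ.≃ ℚᵘ.mkℚᵘ (ℤ.+ s) 0
  unnormalised = ℚᵘ.*≡* (eq (ℤ.+ s))

HalfIntegral : ℚ → Set
HalfIntegral q = Σ ℕ λ a → Σ ℕ λ c → q + q ≡ ι a - ι c

halfIntegral-+ : ∀ {p q} → HalfIntegral p → HalfIntegral q → HalfIntegral (p + q)
halfIntegral-+ {p} {q} (a , c , 2p≡) (a′ , c′ , 2q≡) = a ℕ.+ a′ , c ℕ.+ c′ , (begin
  (p + q) + (p + q)             ≡⟨ eq₁ p q ⟩
  (p + p) + (q + q)             ≡⟨ cong₂ _+_ 2p≡ 2q≡ ⟩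
  (ι a - ι c) + (ι a′ - ι c′)   ≡⟨ eq₂ (ι a) (ι c) (ι a′) (ι c′) ⟩
  (ι a + ι a′) - (ι c + ι c′)   ≡⟨ sym (cong₂ _-_ (ι-+ a a′) (ι-+ c c′)) ⟩
  ι (a ℕ.+ a′) - ι (c ℕ.+ c′)   ∎)
  where
  open ≡-Reasoning
  eq₁ : ∀ p q → (p + q) + (p + q) ≡ (p + p) + (q + q)
  eq₁ = solve-∀ ringℚ
  eq₂ : ∀ a c a′ c′ → (a - c) + (a′ - c′) ≡ (a + a′) - (c + c′)
  eq₂ = solve-∀ ringℚ

halfIntegral-sum : ∀ {m} (f : Fin m → ℚ) → (∀ i → HalfIntegral (f i)) → HalfIntegral (sumℚ f)
halfIntegral-sum {zero}  f _     = 0 , 0 , refl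
halfIntegral-sum {suc m} f f-half =
  halfIntegral-+ {f Fin.zero} {sumℚ (f ∘′ Fin.suc)} (f-half Fin.zero)
                 (halfIntegral-sum (f ∘′ Fin.suc) (λ i → f-half (Fin.suc i)))

halfIntegral-*bit : ∀ {q x} → HalfIntegral q → x ≡ 0ℚ ⊎ x ≡ 1ℚ → HalfIntegral (q * x)
halfIntegral-*bit {q} _      (inj₁ refl) = subst HalfIntegral (sym (*-zeroʳ q)) (0 , 0 , refl)
halfIntegral-*bit {q} q-half (inj₂ refl) = subst HalfIntegral (sym (*-identityʳ q)) q-half

does-≢ : ∀ {m} {i l : Fin m} → i ≢ l → does (i Fin.≟ l) ≡ false
does-≢ {i = i} {l} i≢l with i Fin.≟ l
... | yes i≡l = ⊥-elim (i≢l i≡l)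
... | no _    = refl

does-refl : ∀ {m} (i : Fin m) → does (i Fin.≟ i) ≡ true
does-refl i with i Fin.≟ i
... | yes _  = refl
... | no i≢i = ⊥-elim (i≢i refl)

sumℚ-cong : ∀ {m} {f g : Fin m → ℚ} → (∀ i → f i ≡ g i) → sumℚ f ≡ sumℚ g
sumℚ-cong {zero}  f≗g = refl
sumℚ-cong {suc m} f≗g = cong₂ _+_ (f≗g Fin.zero) (sumℚ-cong (λ i → f≗g (Fin.suc i)))

sumℚ-+ : ∀ {m} (f g : Fin m → ℚ) → sumℚ (λ i → f i + g i) ≡ sumℚ f + sumℚ g
sumℚ-+ {zero}  f g = refl
sumℚ-+ {suc m} f g =
  trans (cong (f Fin.zero + g Fin.zero +_) (sumℚ-+ (f ∘′ Fin.suc) (g ∘′ Fin.suc)))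
        (eq (f Fin.zero) (g Fin.zero) _ _)
  where eq : ∀ a b c d → a + b + (c + d) ≡ a + c + (b + d)
        eq = solve-∀ ringℚ

sumℚ-*ˡ : ∀ {m} k (f : Fin m → ℚ) → sumℚ (λ i → k * f i) ≡ k * sumℚ f
sumℚ-*ˡ {zero}  k f = sym (*-zeroʳ k)
sumℚ-*ˡ {suc m} k f =
  trans (cong (k * f Fin.zero +_) (sumℚ-*ˡ k (f ∘′ Fin.suc))) (sym (*-distribˡ-+ k _ _))

sumℚ-zero : ∀ {m} → sumℚ {m} (λ _ → 0ℚ) ≡ 0ℚ
sumℚ-zero {zero}  = refl
sumℚ-zero {suc m} = trans (+-identityˡ _) (sumℚ-zero {m})

sumℚ-mono : ∀ {m} {f g : Fin m → ℚ} → (∀ i → f i ≤ g i) → sumℚ f ≤ sumℚ g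
sumℚ-mono {zero}  f≤g = ≤-refl
sumℚ-mono {suc m} f≤g = +-mono-≤ (f≤g Fin.zero) (sumℚ-mono (λ i → f≤g (Fin.suc i)))

+-mono-≤-tight : ∀ {a a′ b b′} → a ≤ a′ → b ≤ b′ → a′ + b′ ≤ a + b → a ≡ a′ × b ≡ b′
+-mono-≤-tight {a} {a′} {b} {b′} a≤a′ b≤b′ a′+b′≤a+b =
  ≤-antisym a≤a′ (≤-from-diff _ (0≤+ (0≤-diff a′+b′≤a+b) (0≤-diff b≤b′)) (eq₁ a a′ b b′)) ,
  ≤-antisym b≤b′ (≤-from-diff _ (0≤+ (0≤-diff a′+b′≤a+b) (0≤-diff a≤a′)) (eq₂ a a′ b b′))
  where
  eq₁ : ∀ a a′ b b′ → a - a′ ≡ (a + b) - (a′ + b′) + (b′ - b)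
  eq₁ = solve-∀ ringℚ
  eq₂ : ∀ a a′ b b′ → b - b′ ≡ (a + b) - (a′ + b′) + (a′ - a)
  eq₂ = solve-∀ ringℚ

sumℚ-mono-tight : ∀ {m} {f g : Fin m → ℚ} → (∀ i → f i ≤ g i) → sumℚ g ≤ sumℚ f → ∀ i → f i ≡ g i
sumℚ-mono-tight {suc m} {f} {g} f≤g Σg≤Σf = pick
  where
  split : f Fin.zero ≡ g Fin.zero × sumℚ (f ∘′ Fin.suc) ≡ sumℚ (g ∘′ Fin.suc)
  split = +-mono-≤-tight (f≤g Fin.zero) (sumℚ-mono (λ i → f≤g (Fin.suc i))) Σg≤Σf
  pick : ∀ i → f i ≡ g i
  pick Fin.zero    = proj₁ split
  pick (Fin.suc i) = sumℚ-mono-tight (λ j → f≤g (Fin.suc j)) (≤-reflexive (sym (proj₂ split))) i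

sumℚ-single : ∀ {m} (f : Fin m → ℚ) l → (∀ i → i ≢ l → f i ≡ 0ℚ) → sumℚ f ≡ f l
sumℚ-single {suc m} f Fin.zero f≡0 =
  trans (cong (f Fin.zero +_) (trans (sumℚ-cong (λ i → f≡0 (Fin.suc i) λ ())) (sumℚ-zero {m})))
        (+-identityʳ _)
sumℚ-single {suc m} f (Fin.suc l) f≡0 =
  trans (cong₂ _+_ (f≡0 Fin.zero λ ()) (sumℚ-single (f ∘′ Fin.suc) l (λ i i≢l → f≡0 (Fin.suc i) (i≢l ∘′ suc-injective))))
        (+-identityˡ _)

sumℚ-last : ∀ {m} (f : Fin (suc m) → ℚ) → sumℚ f ≡ sumℚ (f ∘′ Fin.inject₁) + f (Fin.fromℕ m)
sumℚ-last {zero}  f = trans (+-identityʳ (f Fin.zero)) (sym (+-identityˡ (f Fin.zero)))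
sumℚ-last {suc m} f =
  trans (cong (f Fin.zero +_) (sumℚ-last (f ∘′ Fin.suc))) (sym (+-assoc (f Fin.zero) _ _))

module _ {m : ℕ} where

  infixl 6 _⊕_ _⊖_
  infixl 7 _⊙_

  _⊕_ _⊖_ : Vecℚ m → Vecℚ m → Vecℚ m
  (x ⊕ y) i = x i + y i
  (x ⊖ y) i = x i - y i

  _⊙_ : ℚ → Vecℚ m → Vecℚ m
  (k ⊙ x) i = k * x i

  δ : Fin m → ℚ → Vecℚ m
  δ l a i = if does (i Fin.≟ l) then a else 0ℚ

  δ-at : ∀ l a → δ l a l ≡ a
  δ-at l a = cong (λ c → if c then a else 0ℚ) (does-refl l)

  δ-off : ∀ {l i} a → i ≢ l → δ l a i ≡ 0ℚ
  δ-off a i≢l = cong (λ c → if c then a else 0ℚ) (does-≢ i≢l)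

  dot-cong : ∀ c {x y : Vecℚ m} → x ≐ y → dot c x ≡ dot c y
  dot-cong c x≐y = sumℚ-cong (λ i → cong (c i *_) (x≐y i))

  dot-⊕ : ∀ c x y → dot c (x ⊕ y) ≡ dot c x + dot c y
  dot-⊕ c x y = trans (sumℚ-cong (λ i → *-distribˡ-+ (c i) (x i) (y i))) (sumℚ-+ {m} _ _)

  dot-⊙ : ∀ c k x → dot c (k ⊙ x) ≡ k * dot c x
  dot-⊙ c k x = trans (sumℚ-cong (λ i → eq (c i) k (x i))) (sumℚ-*ˡ {m} k _)
    where eq : ∀ a k x → a * (k * x) ≡ k * (a * x)
          eq = solve-∀ ringℚ

  dot-⊖ : ∀ c x y → dot c (x ⊖ y) ≡ dot c x - dot c y
  dot-⊖ c x y = begin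
    dot c (x ⊖ y)                     ≡⟨ sumℚ-cong (λ i → eq (c i) (x i) (y i)) ⟩
    dot c (x ⊕ (- 1ℚ) ⊙ y)            ≡⟨ dot-⊕ c x _ ⟩
    dot c x + dot c ((- 1ℚ) ⊙ y)      ≡⟨ cong (dot c x +_) (dot-⊙ c (- 1ℚ) y) ⟩
    dot c x + (- 1ℚ) * dot c y        ≡⟨ eq′ (dot c x) (dot c y) ⟩
    dot c x - dot c y                 ∎
    where
    open ≡-Reasoning
    eq : ∀ c x y → c * (x - y) ≡ c * (x + (- 1ℚ) * y)
    eq = solve-∀ ringℚ
    eq′ : ∀ a b → a + (- 1ℚ) * b ≡ a - b
    eq′ = solve-∀ ringℚ

  dot-δ : ∀ c l a → dot c (δ l a) ≡ c l * a
  dot-δ c l a =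
    trans (sumℚ-single _ l (λ i i≢l → trans (cong (c i *_) (δ-off a i≢l)) (*-zeroʳ (c i))))
          (cong (c l *_) (δ-at l a))

  dot-segment : ∀ c u v t → dot c (u ⊕ t ⊙ (v ⊖ u)) ≡ dot c u + t * (dot c v - dot c u)
  dot-segment c u v t =
    trans (dot-⊕ c u _) (cong (dot c u +_) (trans (dot-⊙ c t _) (cong (t *_) (dot-⊖ c v u))))

-- Edges of the unit cube cut by a halfspace

-- ε * ∣ c ∣ ≤ a says that moving by ±ε along c stays within distance a.
room : ∀ {a} c → 0ℚ ≤ a → c ≡ 0ℚ ⊎ 0ℚ < a → Σ ℚ λ ε → 0ℚ < ε × ε * ∣ c ∣ ≤ a
room {a} c 0≤a (inj₁ refl) = 1ℚ , 0<1 , 0≤a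
room {a} c 0≤a (inj₂ 0<a)  = ε , 0<ε , ≤-from-diff ε (<⇒≤ 0<ε) a-ε∣c∣≡ε
  where
  q = 1ℚ + ∣ c ∣
  0<q : 0ℚ < q
  0<q = 0<+ 0<1 (0≤∣p∣ c)
  ε = a ÷′ q
  εq≡a : ε * q ≡ a
  εq≡a = p÷′q*q≡p a q (<⇒≢ 0<q ∘′ sym)
  0<ε : 0ℚ < ε
  0<ε = *-cancelʳ-<-nonNeg q {{nonNegative (<⇒≤ 0<q)}}
          (subst₂ _<_ (sym (*-zeroˡ q)) (sym εq≡a) 0<a)
  a-ε∣c∣≡ε : a - ε * ∣ c ∣ ≡ ε
  a-ε∣c∣≡ε = trans (cong (_- ε * ∣ c ∣) (sym εq≡a)) (eq ε ∣ c ∣)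
    where eq : ∀ e x → e * (1ℚ + x) - e * x ≡ e
          eq = solve-∀ ringℚ

room-mono : ∀ {ε ε′ a} c → ε′ ≤ ε → ε * ∣ c ∣ ≤ a → ε′ * ∣ c ∣ ≤ a
room-mono c ε′≤ε εc≤a = ≤-trans (*-monoʳ-≤-nonNeg ∣ c ∣ {{nonNegative (0≤∣p∣ c)}} ε′≤ε) εc≤a

common-room : ∀ {m} (a c : Fin m → ℚ) → (∀ i → 0ℚ ≤ a i) → (∀ i → c i ≡ 0ℚ ⊎ 0ℚ < a i) →
              Σ ℚ λ ε → 0ℚ < ε × (∀ i → ε * ∣ c i ∣ ≤ a i)
common-room {zero}  a c 0≤a c≡0∨0<a = 1ℚ , 0<1 , λ ()
common-room {suc m} a c 0≤a c≡0∨0<a = ε₀ ⊓ ε₁ , 0<⊓ 0<ε₀ 0<ε₁ , bound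
  where
  head = room (c Fin.zero) (0≤a Fin.zero) (c≡0∨0<a Fin.zero)
  tail = common-room (a ∘′ Fin.suc) (c ∘′ Fin.suc) (λ i → 0≤a (Fin.suc i)) (λ i → c≡0∨0<a (Fin.suc i))
  ε₀ = proj₁ head
  0<ε₀ = proj₁ (proj₂ head)
  ε₁ = proj₁ tail
  0<ε₁ = proj₁ (proj₂ tail)
  bound : ∀ i → (ε₀ ⊓ ε₁) * ∣ c i ∣ ≤ a i
  bound Fin.zero    = room-mono (c Fin.zero) (p⊓q≤p ε₀ ε₁) (proj₂ (proj₂ head))
  bound (Fin.suc i) = room-mono (c (Fin.suc i)) (p⊓q≤q ε₀ ε₁) (proj₂ (proj₂ tail) i)

±-bounds : ∀ {ε c a} → 0ℚ ≤ ε → ε * ∣ c ∣ ≤ a → ε * c ≤ a × - (ε * c) ≤ a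
±-bounds {ε} {c} 0≤ε εc≤a =
  ≤-trans (*-monoˡ-≤-nonNeg ε {{nonNegative 0≤ε}} (p≤∣p∣ c)) εc≤a ,
  ≤-trans (subst (_≤ ε * ∣ c ∣) (sym (neg-distribʳ-* ε c))
                 (*-monoˡ-≤-nonNeg ε {{nonNegative 0≤ε}} (-p≤∣p∣ c))) εc≤a

+-≤-from-room : ∀ {p q e} → e ≤ q - p → p + e ≤ q
+-≤-from-room {p} {q} {e} e≤q-p = ≤-from-diff _ (0≤-diff e≤q-p) (eq p q e)
  where eq : ∀ p q e → q - (p + e) ≡ (q - p) - e
        eq = solve-∀ ringℚ

0≤+-from-room : ∀ {p e} → - e ≤ p → 0ℚ ≤ p + e
0≤+-from-room {p} {e} -e≤p = ≤-from-diff _ (0≤-diff -e≤p) (eq p e)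
  where eq : ∀ p e → p + e - 0ℚ ≡ p - - e
        eq = solve-∀ ringℚ

unit-±-from-room : ∀ {x e} → e ≤ x × - e ≤ x → e ≤ 1ℚ - x × - e ≤ 1ℚ - x →
                   ((0ℚ ≤ x + e) × (x + e ≤ 1ℚ)) × ((0ℚ ≤ x - e) × (x - e ≤ 1ℚ))
unit-±-from-room {x} {e} (e≤x , -e≤x) (e≤1-x , -e≤1-x) =
  (0≤+-from-room -e≤x , +-≤-from-room {x} e≤1-x) ,
  (0≤+-from-room (subst (_≤ x) (eq e) e≤x) , +-≤-from-room {x} -e≤1-x)
  where eq : ∀ e → e ≡ - - e
        eq = solve-∀ ringℚ

module _ {m : ℕ} {u v z : Vecℚ m} {s : ℚ} (z∥v-u : z ≐ (s ⊙ (v ⊖ u))) where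

  parallel-fixes : ∀ {i j} → z j ≢ 0ℚ → z i ≡ 0ℚ → v i ≡ u i
  parallel-fixes {i} {j} zj≢0 zi≡0 with p*q≡0⇒p≡0∨q≡0 s (v i - u i) (trans (sym (z∥v-u i)) zi≡0)
  ... | inj₂ vi-ui≡0 = p-q≡0⇒p≡q vi-ui≡0
  ... | inj₁ s≡0     = ⊥-elim (zj≢0 (trans (z∥v-u j) (trans (cong (_* (v j - u j)) s≡0) (*-zeroˡ (v j - u j)))))

  parallel-moves : ∀ {i} → v i ≡ u i → z i ≡ 0ℚ
  parallel-moves {i} vi≡ui =
    trans (z∥v-u i) (trans (cong (λ t → s * (t - u i)) vi≡ui) (trans (cong (s *_) (+-inverseʳ (u i))) (*-zeroʳ s)))

data Pin : Set where
  pin₀ pin₁ free : Pin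

pinSign pinBound : Pin → ℚ
pinSign pin₀  = - 1ℚ
pinSign pin₁  = 1ℚ
pinSign free  = 0ℚ

pinBound pin₁ = 1ℚ
pinBound _    = 0ℚ

Pinned : Pin → ℚ → Set
Pinned pin₀ q = q ≡ 0ℚ
Pinned pin₁ q = q ≡ 1ℚ
Pinned free q = ⊤

pin-≤ : ∀ p {q} → 0ℚ ≤ q → q ≤ 1ℚ → pinSign p * q ≤ pinBound p
pin-≤ pin₀ {q} 0≤q q≤1 = ≤-from-diff q 0≤q (eq q)
  where eq : ∀ q → 0ℚ - (- 1ℚ) * q ≡ q
        eq = solve-∀ ringℚ
pin-≤ pin₁ {q} 0≤q q≤1 = subst (_≤ 1ℚ) (sym (*-identityˡ q)) q≤1
pin-≤ free {q} 0≤q q≤1 = ≤-reflexive (*-zeroˡ q)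

pin-≡⇒pinned : ∀ p {q} → pinSign p * q ≡ pinBound p → Pinned p q
pin-≡⇒pinned pin₀ {q} e = trans (eq q) (cong -_ e)
  where eq : ∀ q → q ≡ - ((- 1ℚ) * q)
        eq = solve-∀ ringℚ
pin-≡⇒pinned pin₁ {q} e = trans (sym (*-identityˡ q)) e
pin-≡⇒pinned free e = tt

pinned⇒pin-≡ : ∀ p {q} → Pinned p q → pinSign p * q ≡ pinBound p
pinned⇒pin-≡ pin₀ refl = refl
pinned⇒pin-≡ pin₁ refl = refl
pinned⇒pin-≡ free {q} _ = *-zeroˡ q

pinAt : ℚ → Pin
pinAt q = if does (q ≟ 1ℚ) then pin₁ else pin₀

pinAt-pinned : ∀ {q} → q ≡ 0ℚ ⊎ q ≡ 1ℚ → Pinned (pinAt q) q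
pinAt-pinned {q} q-bit with q ≟ 1ℚ | q-bit
... | yes q≡1 | _        = q≡1
... | no _    | inj₁ q≡0 = q≡0
... | no q≢1  | inj₂ q≡1 = ⊥-elim (q≢1 q≡1)

pinAt-unique : ∀ {q q′} → q ≡ 0ℚ ⊎ q ≡ 1ℚ → Pinned (pinAt q) q′ → q′ ≡ q
pinAt-unique {q} q-bit pinned with q ≟ 1ℚ | q-bit
... | yes q≡1 | _        = trans pinned (sym q≡1)
... | no _    | inj₁ q≡0 = trans pinned (sym q≡0)
... | no q≢1  | inj₂ q≡1 = ⊥-elim (q≢1 q≡1)

pinsOutside : ∀ {n} {Free : Fin n → Set} → (∀ i → Dec (Free i)) → Vecℚ n → Fin n → Pin
pinsOutside free? x i = if does (free? i) then free else pinAt (x i)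

module _ {n} {Free : Fin n → Set} (free? : ∀ i → Dec (Free i)) {x : Vecℚ n}
         (x-bits : ∀ i → ¬ Free i → x i ≡ 0ℚ ⊎ x i ≡ 1ℚ) where

  pinsOutside-pinned : ∀ {y : Vecℚ n} → (∀ i → ¬ Free i → y i ≡ x i) → ∀ i → Pinned (pinsOutside free? x i) (y i)
  pinsOutside-pinned {y} y≡x i with free? i
  ... | yes _    = tt
  ... | no ¬free = subst (Pinned (pinAt (x i))) (sym (y≡x i ¬free)) (pinAt-pinned (x-bits i ¬free))

  pinsOutside-unique : ∀ i {q} → ¬ Free i → Pinned (pinsOutside free? x i) q → q ≡ x i
  pinsOutside-unique i ¬free pinned with free? i
  ... | yes isFree = ⊥-elim (¬free isFree)
  ... | no _       = pinAt-unique (x-bits i ¬free) pinned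

-- Vertex and Edge unfold to IsVertex b and IsEdge b for W = w b and R = β b + ¼.
module Polytope {n : ℕ} (W : Vecℚ n) (R : ℚ) where

  InBox : Vecℚ n → Set
  InBox x = ∀ i → (0ℚ ≤ x i) × (x i ≤ 1ℚ)

  Feasible : Vecℚ n → Set
  Feasible x = InBox x × (dot W x ≤ R)

  Tight : Vecℚ n → Set
  Tight x = dot W x ≡ R

  Vertex : Vecℚ n → Set
  Vertex x = Feasible x × Σ (Vecℚ n) (λ c → ∀ y → Feasible y → ¬ (y ≐ x) → dot c y < dot c x)

  Edge : Vecℚ n → Vecℚ n → Set
  Edge u v =
    Feasible u × Feasible v × ¬ (u ≐ v) ×
    Σ (Vecℚ n) (λ c →
      (∀ y → Feasible y → dot c y ≤ dot c u) ×
      (dot c v ≡ dot c u) ×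
      (∀ y → Feasible y → dot c y ≡ dot c u → OnSegment u v y))

  midpoint : Vecℚ n → Vecℚ n → Vecℚ n
  midpoint u v = u ⊕ ½ ⊙ (v ⊖ u)

  midpoint-feasible : ∀ {u v} → Feasible u → Feasible v → Feasible (midpoint u v)
  midpoint-feasible {u} {v} (u∈box , W·u≤R) (v∈box , W·v≤R) = box , halfspace
    where
    half : ∀ {p q} → 0ℚ ≤ p → 0ℚ ≤ q → 0ℚ ≤ ½ * p + ½ * q
    half 0≤p 0≤q = 0≤+ (0≤* (<⇒≤ 0<½) 0≤p) (0≤* (<⇒≤ 0<½) 0≤q)
    eq₀ : ∀ a b → (a + ½ * (b - a)) - 0ℚ ≡ ½ * a + ½ * b
    eq₀ = solve-∀ ringℚ
    eq₁ : ∀ a b r → r - (a + ½ * (b - a)) ≡ ½ * (r - a) + ½ * (r - b)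
    eq₁ = solve-∀ ringℚ
    box : InBox (midpoint u v)
    box i = ≤-from-diff _ (half (proj₁ (u∈box i)) (proj₁ (v∈box i))) (eq₀ (u i) (v i)) ,
            ≤-from-diff _ (half (0≤-diff (proj₂ (u∈box i))) (0≤-diff (proj₂ (v∈box i)))) (eq₁ (u i) (v i) 1ℚ)
    halfspace : dot W (midpoint u v) ≤ R
    halfspace = subst (_≤ R) (sym (dot-segment W u v ½))
                  (≤-from-diff _ (half (0≤-diff W·u≤R) (0≤-diff W·v≤R)) (eq₁ (dot W u) (dot W v) R))

  perturbation : ∀ {x} z → Feasible x → (∀ i → z i ≡ 0ℚ ⊎ Fractional (x i)) →
                 dot W z ≡ 0ℚ ⊎ dot W x < R →
                 Σ ℚ λ ε → 0ℚ < ε × Feasible (x ⊕ ε ⊙ z) × Feasible (x ⊖ ε ⊙ z)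
  perturbation {x} z (x∈box , W·x≤R) z-fractional W·z≡0∨slack =
    ε , 0<ε , ((λ i → proj₁ (coordinate i)) , halfspace⁺) , ((λ i → proj₂ (coordinate i)) , halfspace⁻)
    where
    a : Fin n → ℚ
    a i = x i ⊓ (1ℚ - x i)
    room-a : ∀ i → z i ≡ 0ℚ ⊎ 0ℚ < a i
    room-a i with z-fractional i
    ... | inj₁ zi≡0        = inj₁ zi≡0
    ... | inj₂ (0<xi , xi<1) = inj₂ (0<⊓ 0<xi (0<-diff xi<1))
    box-room = common-room a z (λ i → ⊓-glb (proj₁ (x∈box i)) (0≤-diff (proj₂ (x∈box i)))) room-a
    halfspace-room = room (dot W z) (0≤-diff W·x≤R) (Data.Sum.map₂ 0<-diff W·z≡0∨slack)
    ε₀ = proj₁ box-room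
    ε₁ = proj₁ halfspace-room
    ε = ε₀ ⊓ ε₁
    0<ε : 0ℚ < ε
    0<ε = 0<⊓ (proj₁ (proj₂ box-room)) (proj₁ (proj₂ halfspace-room))
    coordinate : ∀ i → ((0ℚ ≤ x i + ε * z i) × (x i + ε * z i ≤ 1ℚ)) ×
                       ((0ℚ ≤ x i - ε * z i) × (x i - ε * z i ≤ 1ℚ))
    coordinate i = unit-±-from-room {x i} (≤-trans e≤a (p⊓q≤p (x i) _) , ≤-trans -e≤a (p⊓q≤p (x i) _))
                                    (≤-trans e≤a (p⊓q≤q (x i) _) , ≤-trans -e≤a (p⊓q≤q (x i) _))
      where
      bounds = ±-bounds (<⇒≤ 0<ε) (room-mono (z i) (p⊓q≤p ε₀ ε₁) (proj₂ (proj₂ box-room) i))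
      e≤a = proj₁ bounds
      -e≤a = proj₂ bounds
    W·z-bounds = ±-bounds (<⇒≤ 0<ε) (room-mono (dot W z) (p⊓q≤q ε₀ ε₁) (proj₂ (proj₂ halfspace-room)))
    halfspace⁺ : dot W (x ⊕ ε ⊙ z) ≤ R
    halfspace⁺ = subst (_≤ R) (sym (trans (dot-⊕ W x _) (cong (dot W x +_) (dot-⊙ W ε z))))
                   (+-≤-from-room (proj₁ W·z-bounds))
    halfspace⁻ : dot W (x ⊖ ε ⊙ z) ≤ R
    halfspace⁻ = subst (_≤ R) (sym (trans (dot-⊖ W x _) (cong (λ q → dot W x - q) (dot-⊙ W ε z))))
                   (+-≤-from-room (proj₂ W·z-bounds))

  -- Both x + z and x - z maximise the functional of the edge, so they lie on [u,v].
  edge-direction : ∀ {u v} → Edge u v → ∀ κ {x} z → x ≐ (u ⊕ κ ⊙ (v ⊖ u)) →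
                   Feasible (x ⊕ z) → Feasible (x ⊖ z) → Σ ℚ λ s → z ≐ (s ⊙ (v ⊖ u))
  edge-direction {u} {v} (_ , _ , _ , c , c≤cu , cv≡cu , face) κ {x} z x-on-line x+z∈P x-z∈P =
    t - κ , z-on-line
    where
    open ≡-Reasoning
    cx≡cu : dot c x ≡ dot c u
    cx≡cu = begin
      dot c x                                  ≡⟨ dot-cong c x-on-line ⟩
      dot c (u ⊕ κ ⊙ (v ⊖ u))                  ≡⟨ dot-segment c u v κ ⟩
      dot c u + κ * (dot c v - dot c u)        ≡⟨ cong (λ q → dot c u + κ * (q - dot c u)) cv≡cu ⟩
      dot c u + κ * (dot c u - dot c u)        ≡⟨ eq (dot c u) κ ⟩
      dot c u                                  ∎
      where eq : ∀ a k → a + k * (a - a) ≡ a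
            eq = solve-∀ ringℚ
    cz≡0 : dot c z ≡ 0ℚ
    cz≡0 = ≤-antisym
      (≤-from-diff _ (0≤-diff (subst₂ _≤_ (dot-⊕ c x z) (sym cx≡cu) (c≤cu _ x+z∈P))) (eq₁ (dot c x) (dot c z)))
      (≤-from-diff _ (0≤-diff (subst₂ _≤_ (dot-⊖ c x z) (sym cx≡cu) (c≤cu _ x-z∈P))) (eq₂ (dot c x) (dot c z)))
      where
      eq₁ : ∀ a b → 0ℚ - b ≡ a - (a + b)
      eq₁ = solve-∀ ringℚ
      eq₂ : ∀ a b → b - 0ℚ ≡ a - (a - b)
      eq₂ = solve-∀ ringℚ
    segment = face (x ⊕ z) x+z∈P (trans (dot-⊕ c x z) (trans (cong (dot c x +_) cz≡0) (trans (+-identityʳ _) cx≡cu)))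
    t = proj₁ segment
    z-on-line : z ≐ ((t - κ) ⊙ (v ⊖ u))
    z-on-line i = begin
      z i                                                  ≡⟨ eq₁ (x i) (z i) ⟩
      (x i + z i) - x i                                    ≡⟨ cong₂ _-_ (proj₂ (proj₂ (proj₂ segment)) i) (x-on-line i) ⟩
      (u i + t * (v i - u i)) - (u i + κ * (v i - u i))    ≡⟨ eq₂ (u i) (v i) t κ ⟩
      (t - κ) * (v i - u i)                                ∎
      where
      eq₁ : ∀ x z → z ≡ (x + z) - x
      eq₁ = solve-∀ ringℚ
      eq₂ : ∀ u v t k → (u + t * (v - u)) - (u + k * (v - u)) ≡ (t - k) * (v - u)
      eq₂ = solve-∀ ringℚ

  edge-perturbation : ∀ {u v} → Edge u v → ∀ κ {x} z → x ≐ (u ⊕ κ ⊙ (v ⊖ u)) → Feasible x →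
                      (∀ i → z i ≡ 0ℚ ⊎ Fractional (x i)) → dot W z ≡ 0ℚ ⊎ dot W x < R →
                      Σ ℚ λ ε → 0ℚ < ε × Σ ℚ λ s → (ε ⊙ z) ≐ (s ⊙ (v ⊖ u))
  edge-perturbation uv κ z x-on-line x∈P z-fractional W·z≡0∨slack =
    ε , 0<ε , edge-direction uv κ (ε ⊙ z) x-on-line x+εz∈P x-εz∈P
    where
    perturbed = perturbation z x∈P z-fractional W·z≡0∨slack
    ε = proj₁ perturbed
    0<ε = proj₁ (proj₂ perturbed)
    x+εz∈P = proj₁ (proj₂ (proj₂ perturbed))
    x-εz∈P = proj₂ (proj₂ (proj₂ perturbed))

  δ-fractional : ∀ {x : Vecℚ n} {l} a → Fractional (x l) → ∀ i → δ l a i ≡ 0ℚ ⊎ Fractional (x i)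
  δ-fractional {l = l} a xl-fractional i with i Fin.≟ l
  ... | yes refl = inj₂ xl-fractional
  ... | no _     = inj₁ refl

  slack-midpoint-fixes : ∀ {u v} → Edge u v → dot W (midpoint u v) < R →
                         ∀ {l} → Fractional (mid (u l) (v l)) → ∀ {i} → i ≢ l → v i ≡ u i
  slack-midpoint-fixes {u} {v} uv@(u∈P , v∈P , _) slack {l} ml-fractional {i} i≢l =
    conclude (edge-perturbation uv ½ (δ l 1ℚ) (λ _ → refl) (midpoint-feasible u∈P v∈P)
                                (δ-fractional 1ℚ ml-fractional) (inj₂ slack))
    where
    conclude : (Σ ℚ λ ε → 0ℚ < ε × Σ ℚ λ s → (ε ⊙ δ l 1ℚ) ≐ (s ⊙ (v ⊖ u))) → v i ≡ u i
    conclude (ε , 0<ε , s , εz∥v-u) =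
      parallel-fixes {u = u} {v} {s = s} εz∥v-u {i} {l}
        (*≢0 (<⇒≢ 0<ε ∘′ sym) (subst (_≢ 0ℚ) (sym (δ-at l 1ℚ)) λ ()))
        (trans (cong (ε *_) (δ-off 1ℚ i≢l)) (*-zeroʳ ε))

  fractional-pair-fixes : ∀ {u v} → Edge u v → ∀ {l j} → l ≢ j → W j ≢ 0ℚ →
                          Fractional (mid (u l) (v l)) → Fractional (mid (u j) (v j)) →
                          ∀ {i} → i ≢ l → i ≢ j → v i ≡ u i
  fractional-pair-fixes {u} {v} uv@(u∈P , v∈P , _) {l} {j} l≢j Wj≢0 ml-fractional mj-fractional {i} i≢l i≢j =
    conclude (edge-perturbation uv ½ z (λ _ → refl) (midpoint-feasible u∈P v∈P) z-fractional (inj₁ W·z≡0))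
    where
    z = δ l (W j) ⊕ δ j (- W l)
    W·z≡0 : dot W z ≡ 0ℚ
    W·z≡0 = trans (dot-⊕ W _ _) (trans (cong₂ _+_ (dot-δ W l (W j)) (dot-δ W j (- W l))) (eq (W l) (W j)))
      where eq : ∀ a b → a * b + b * (- a) ≡ 0ℚ
            eq = solve-∀ ringℚ
    z-off : ∀ {k} → k ≢ l → k ≢ j → z k ≡ 0ℚ
    z-off k≢l k≢j = trans (cong₂ _+_ (δ-off (W j) k≢l) (δ-off (- W l) k≢j)) (+-identityˡ 0ℚ)
    zl≡Wj : z l ≡ W j
    zl≡Wj = trans (cong₂ _+_ (δ-at l (W j)) (δ-off (- W l) l≢j)) (+-identityʳ (W j))
    z-fractional : ∀ k → z k ≡ 0ℚ ⊎ Fractional (mid (u k) (v k))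
    z-fractional k with k Fin.≟ l | k Fin.≟ j
    ... | yes refl | _        = inj₂ ml-fractional
    ... | no _     | yes refl = inj₂ mj-fractional
    ... | no _     | no _     = inj₁ (+-identityˡ 0ℚ)
    conclude : (Σ ℚ λ ε → 0ℚ < ε × Σ ℚ λ s → (ε ⊙ z) ≐ (s ⊙ (v ⊖ u))) → v i ≡ u i
    conclude (ε , 0<ε , s , εz∥v-u) =
      parallel-fixes {u = u} {v} {s = s} εz∥v-u {i} {l}
        (*≢0 (<⇒≢ 0<ε ∘′ sym) (subst (_≢ 0ℚ) (sym zl≡Wj) Wj≢0))
        (trans (cong (ε *_) (z-off i≢l i≢j)) (*-zeroʳ ε))

  slack-endpoint-moves : ∀ {u v} → Edge u v → dot W v < R → ∀ {l} → Fractional (v l) → v l ≢ u l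
  slack-endpoint-moves {u} {v} uv@(_ , v∈P , _) slack {l} vl-fractional vl≡ul =
    conclude (edge-perturbation uv 1ℚ (δ l 1ℚ) v-on-line v∈P (δ-fractional 1ℚ vl-fractional) (inj₂ slack))
    where
    v-on-line : v ≐ (u ⊕ 1ℚ ⊙ (v ⊖ u))
    v-on-line i = eq (u i) (v i)
      where eq : ∀ u v → v ≡ u + 1ℚ * (v - u)
            eq = solve-∀ ringℚ
    conclude : (Σ ℚ λ ε → 0ℚ < ε × Σ ℚ λ s → (ε ⊙ δ l 1ℚ) ≐ (s ⊙ (v ⊖ u))) → ⊥
    conclude (ε , 0<ε , s , εz∥v-u) =
      *≢0 (<⇒≢ 0<ε ∘′ sym) (subst (_≢ 0ℚ) (sym (δ-at l 1ℚ)) λ ())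
          (parallel-moves {u = u} {v} {s = s} εz∥v-u {l} vl≡ul)

  -- Tilting W by ±1 on the pinned coordinates gives a functional whose maximisers
  -- over the polytope are exactly the tight points with the prescribed pinned values.
  objective : (Fin n → Pin) → Vecℚ n
  objective π i = W i + pinSign (π i)

  objectiveMax : (Fin n → Pin) → ℚ
  objectiveMax π = R + sumℚ (λ i → pinBound (π i))

  dot-objective : ∀ π y → dot (objective π) y ≡ dot W y + sumℚ (λ i → pinSign (π i) * y i)
  dot-objective π y =
    trans (sumℚ-cong (λ i → *-distribʳ-+ (y i) (W i) (pinSign (π i)))) (sumℚ-+ (λ i → W i * y i) _)

  objective-≤ : ∀ π {y} → Feasible y → dot (objective π) y ≤ objectiveMax π
  objective-≤ π {y} (y∈box , W·y≤R) =
    subst (_≤ objectiveMax π) (sym (dot-objective π y))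
      (+-mono-≤ W·y≤R (sumℚ-mono (λ i → pin-≤ (π i) (proj₁ (y∈box i)) (proj₂ (y∈box i)))))

  objective-maximiser : ∀ π {y} → Feasible y → objectiveMax π ≤ dot (objective π) y →
                        Tight y × (∀ i → Pinned (π i) (y i))
  objective-maximiser π {y} (y∈box , W·y≤R) max≤ =
    proj₁ tight , λ i → pin-≡⇒pinned (π i) (sumℚ-mono-tight pin≤ (≤-reflexive (sym (proj₂ tight))) i)
    where
    pin≤ : ∀ i → pinSign (π i) * y i ≤ pinBound (π i)
    pin≤ i = pin-≤ (π i) (proj₁ (y∈box i)) (proj₂ (y∈box i))
    tight = +-mono-≤-tight W·y≤R (sumℚ-mono pin≤) (subst (objectiveMax π ≤_) (dot-objective π y) max≤)

  objective-attained : ∀ π {x} → Tight x → (∀ i → Pinned (π i) (x i)) → dot (objective π) x ≡ objectiveMax π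
  objective-attained π {x} tight pinned =
    trans (dot-objective π x) (cong₂ _+_ tight (sumℚ-cong (λ i → pinned⇒pin-≡ (π i) (pinned i))))

  tight-agree : ∀ {L x y} → W L ≢ 0ℚ → Tight x → Tight y → (∀ i → i ≢ L → y i ≡ x i) → y ≐ x
  tight-agree {L} {x} {y} WL≢0 x-tight y-tight agree i with i Fin.≟ L
  ... | no i≢L   = agree i i≢L
  ... | yes refl = at-L (p*q≡0⇒p≡0∨q≡0 (W L) (y L - x L) WL*[yL-xL]≡0)
    where
    W*[y-x]≡0 : ∀ i → i ≢ L → W i * (y i - x i) ≡ 0ℚ
    W*[y-x]≡0 i i≢L =
      trans (cong (λ q → W i * (q - x i)) (agree i i≢L)) (trans (cong (W i *_) (+-inverseʳ (x i))) (*-zeroʳ (W i)))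
    WL*[yL-xL]≡0 : W L * (y L - x L) ≡ 0ℚ
    WL*[yL-xL]≡0 = begin
      W L * (y L - x L)     ≡⟨ sym (sumℚ-single _ L W*[y-x]≡0) ⟩
      dot W (y ⊖ x)         ≡⟨ dot-⊖ W y x ⟩
      dot W y - dot W x     ≡⟨ cong₂ _-_ y-tight x-tight ⟩
      R - R                 ≡⟨ +-inverseʳ R ⟩
      0ℚ                    ∎
      where open ≡-Reasoning
    at-L : W L ≡ 0ℚ ⊎ y L - x L ≡ 0ℚ → y L ≡ x L
    at-L (inj₁ WL≡0)    = ⊥-elim (WL≢0 WL≡0)
    at-L (inj₂ yL-xL≡0) = p-q≡0⇒p≡q yL-xL≡0

  -- u + (y l) (v - u) is tight and agrees with y outside L, so tight-agree applies.
  tight-on-line : ∀ {L l u v y} → W L ≢ 0ℚ → Tight u → Tight v → Tight y →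
                  (∀ i → i ≢ L → i ≢ l → v i ≡ u i) → (∀ i → i ≢ L → i ≢ l → y i ≡ u i) →
                  u l ≡ 0ℚ → v l ≡ 1ℚ → y ≐ (u ⊕ y l ⊙ (v ⊖ u))
  tight-on-line {L} {l} {u} {v} {y} WL≢0 u-tight v-tight y-tight v≡u y≡u ul≡0 vl≡1 =
    tight-agree WL≢0 z-tight y-tight y≡z-off-L
    where
    t = y l
    z = u ⊕ t ⊙ (v ⊖ u)
    z-tight : Tight z
    z-tight = trans (dot-segment W u v t) (trans (cong₂ (λ p q → p + t * (q - p)) u-tight v-tight) (eq R t))
      where eq : ∀ r t → r + t * (r - r) ≡ r
            eq = solve-∀ ringℚ
    y≡z-off-L : ∀ i → i ≢ L → y i ≡ z i
    y≡z-off-L i i≢L with i Fin.≟ l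
    ... | yes refl = sym (trans (cong₂ (λ p q → p + t * (q - p)) ul≡0 vl≡1) (eq t))
      where eq : ∀ t → 0ℚ + t * (1ℚ - 0ℚ) ≡ t
            eq = solve-∀ ringℚ
    ... | no i≢l   = trans (y≡u i i≢L i≢l) (sym (trans (cong (λ q → u i + t * (q - u i)) (v≡u i i≢L i≢l)) (eq (u i) t)))
      where eq : ∀ a t → a + t * (a - a) ≡ a
            eq = solve-∀ ringℚ

  pinned-vertex : ∀ {L x} → W L ≢ 0ℚ → Feasible x → Tight x → (∀ i → i ≢ L → x i ≡ 0ℚ ⊎ x i ≡ 1ℚ) → Vertex x
  pinned-vertex {L} {x} WL≢0 x∈P x-tight x-bits = x∈P , objective π , below-max
    where
    free? : ∀ i → Dec (i ≡ L)
    free? i = i Fin.≟ L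
    π = pinsOutside free? x
    x-max : dot (objective π) x ≡ objectiveMax π
    x-max = objective-attained π x-tight (pinsOutside-pinned free? x-bits {x} (λ _ _ → refl))
    below-max : ∀ y → Feasible y → ¬ (y ≐ x) → dot (objective π) y < dot (objective π) x
    below-max y y∈P y≠x with ≤⇒<∨≡ (objective-≤ π y∈P)
    ... | inj₁ y<max = subst (dot (objective π) y <_) (sym x-max) y<max
    ... | inj₂ y≡max = ⊥-elim (y≠x (tight-agree WL≢0 x-tight (proj₁ maximiser) off-L))
      where
      maximiser = objective-maximiser π y∈P (≤-reflexive (sym y≡max))
      off-L : ∀ i → i ≢ L → y i ≡ x i
      off-L i i≢L = pinsOutside-unique free? x-bits i i≢L (proj₂ maximiser i)

  pinned-edge : ∀ {L l u v} → W L ≢ 0ℚ → Feasible u → Feasible v → Tight u → Tight v →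
                (∀ i → i ≢ L → i ≢ l → u i ≡ 0ℚ ⊎ u i ≡ 1ℚ) → (∀ i → i ≢ L → i ≢ l → v i ≡ u i) →
                u l ≡ 0ℚ → v l ≡ 1ℚ → Edge u v
  pinned-edge {L} {l} {u} {v} WL≢0 u∈P v∈P u-tight v-tight u-bits v≡u ul≡0 vl≡1 =
    u∈P , v∈P , u≠v , objective π , (λ y y∈P → subst (dot (objective π) y ≤_) (sym u-max) (objective-≤ π y∈P)) ,
    trans v-max (sym u-max) , face
    where
    Free : Fin n → Set
    Free i = i ≡ L ⊎ i ≡ l
    free? : ∀ i → Dec (Free i)
    free? i = (i Fin.≟ L) ⊎-dec (i Fin.≟ l)
    bits : ∀ i → ¬ Free i → u i ≡ 0ℚ ⊎ u i ≡ 1ℚ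
    bits i ¬free = u-bits i (¬free ∘′ inj₁) (¬free ∘′ inj₂)
    π = pinsOutside free? u
    u-max : dot (objective π) u ≡ objectiveMax π
    u-max = objective-attained π u-tight (pinsOutside-pinned free? bits {u} (λ _ _ → refl))
    v-pinned : ∀ i → Pinned (π i) (v i)
    v-pinned = pinsOutside-pinned free? bits {v} (λ i ¬free → v≡u i (¬free ∘′ inj₁) (¬free ∘′ inj₂))
    v-max : dot (objective π) v ≡ objectiveMax π
    v-max = objective-attained π v-tight v-pinned
    u≠v : ¬ (u ≐ v)
    u≠v u≐v = <⇒≢ 0<1 (trans (sym ul≡0) (trans (u≐v l) vl≡1))
    face : ∀ y → Feasible y → dot (objective π) y ≡ dot (objective π) u → OnSegment u v y
    face y y∈P y-max =
      y l , proj₁ (proj₁ y∈P l) , proj₂ (proj₁ y∈P l) ,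
      tight-on-line WL≢0 u-tight v-tight (proj₁ maximiser) v≡u y≡u ul≡0 vl≡1
      where
      maximiser = objective-maximiser π y∈P (≤-reflexive (sym (trans y-max u-max)))
      y≡u : ∀ i → i ≢ L → i ≢ l → y i ≡ u i
      y≡u i i≢L i≢l = pinsOutside-unique free? bits i (Data.Sum.[_,_] i≢L i≢l) (proj₂ maximiser i)

  AlmostIntegral : Fin n → Vecℚ n → Set
  AlmostIntegral L u = Tight u × (∀ i → i ≢ L → u i ≡ 0ℚ ⊎ u i ≡ 1ℚ) × Fractional (u L)

  raised-midpoint-fractional : ∀ {u v : Vecℚ n} → InBox u → ∀ {l} → v l ≡ 1ℚ → u l ≢ 1ℚ → Fractional (mid (u l) (v l))
  raised-midpoint-fractional {u} {v} u∈box {l} vl≡1 ul≢1 =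
    subst (λ q → Fractional (mid (u l) q)) (sym vl≡1)
      (mid-fractional (proj₁ (u∈box l)) (proj₂ (u∈box l)) (<⇒≤ 0<1) ≤-refl
                      (inj₂ 0<1) (inj₁ (≤∧≢⇒< (proj₂ (u∈box l)) ul≢1)))

  module Nondegenerate (W≢0 : ∀ i → W i ≢ 0ℚ)
                       (not-tight-01 : ∀ x → (∀ i → x i ≡ 0ℚ ⊎ x i ≡ 1ℚ) → ¬ Tight x) where

    -- If the midpoint is slack, one fractional coordinate pins all others; if it is
    -- tight, two fractional coordinates pin the rest, and an integral tight point cannot exist.
    at-most-one-raised : ∀ {u v} → Edge u v → ∀ {l l′} → l ≢ l′ →
                         v l ≡ 1ℚ → u l ≢ 1ℚ → v l′ ≡ 1ℚ → u l′ ≢ 1ℚ → ⊥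
    at-most-one-raised {u} {v} uv@(u∈P@(u∈box , W·u≤R) , v∈P@(v∈box , W·v≤R) , _) {l} {l′}
                       l≢l′ vl≡1 ul≢1 vl′≡1 ul′≢1 = by-midpoint (≤⇒<∨≡ (proj₂ (midpoint-feasible u∈P v∈P)))
      where
      ml-fractional = raised-midpoint-fractional {v = v} u∈box vl≡1 ul≢1
      ml′-fractional = raised-midpoint-fractional {v = v} u∈box vl′≡1 ul′≢1
      ThirdFractional : Fin n → Set
      ThirdFractional j = j ≢ l × j ≢ l′ × Fractional (mid (u j) (v j))
      third? : ∀ j → Dec (ThirdFractional j)
      third? j = ¬? (j Fin.≟ l) ×-dec ¬? (j Fin.≟ l′) ×-dec fractional? (mid (u j) (v j))
      v-bits : ¬ (∃ ThirdFractional) → ∀ i → v i ≡ 0ℚ ⊎ v i ≡ 1ℚ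
      v-bits no-third i with i Fin.≟ l | i Fin.≟ l′
      ... | yes refl | _        = inj₂ vl≡1
      ... | no _     | yes refl = inj₂ vl′≡1
      ... | no i≢l   | no i≢l′  = bit (mid-cases (proj₁ (u∈box i)) (proj₂ (u∈box i)) (proj₁ (v∈box i)) (proj₂ (v∈box i)))
        where
        bit : (u i ≡ 0ℚ × v i ≡ 0ℚ) ⊎ (u i ≡ 1ℚ × v i ≡ 1ℚ) ⊎ Fractional (mid (u i) (v i)) → v i ≡ 0ℚ ⊎ v i ≡ 1ℚ
        bit (inj₁ (_ , vi≡0))        = inj₁ vi≡0
        bit (inj₂ (inj₁ (_ , vi≡1))) = inj₂ vi≡1
        bit (inj₂ (inj₂ fractional)) = ⊥-elim (no-third (i , i≢l , i≢l′ , fractional))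
      by-third : Tight (midpoint u v) → Dec (∃ ThirdFractional) → ⊥
      by-third _ (yes (j , j≢l , j≢l′ , mj-fractional)) =
        ul≢1 (trans (sym (fractional-pair-fixes uv (j≢l′ ∘′ sym) (W≢0 j) ml′-fractional mj-fractional
                                                l≢l′ (j≢l ∘′ sym))) vl≡1)
      by-third m-tight (no no-third) =
        not-tight-01 v (v-bits no-third) (mid≡⇒≡ W·u≤R W·v≤R (trans (sym (dot-segment W u v ½)) m-tight))
      by-midpoint : dot W (midpoint u v) < R ⊎ Tight (midpoint u v) → ⊥
      by-midpoint (inj₁ slack)  = ul′≢1 (trans (sym (slack-midpoint-fixes uv slack ml-fractional (l≢l′ ∘′ sym))) vl′≡1)
      by-midpoint (inj₂ m-tight) = by-third m-tight (any? third?)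

    -- A slack midpoint would fix v L = u L, whereas a slack endpoint must move its
    -- fractional coordinate; a tight midpoint fixes everything outside {l, L}.
    almost-integral-step : ∀ {L u v} → Edge u v → AlmostIntegral L u → ∀ {l} → l ≢ L → v l ≡ 1ℚ → u l ≢ 1ℚ →
                           AlmostIntegral L v × (∀ i → i ≢ l → i ≢ L → v i ≡ u i)
    almost-integral-step {L} {u} {v} uv@(u∈P@(u∈box , W·u≤R) , v∈P@(v∈box , W·v≤R) , _)
                         (u-tight , u-bits , uL-fractional) {l} l≢L vl≡1 ul≢1 =
      by-midpoint (≤⇒<∨≡ (proj₂ (midpoint-feasible u∈P v∈P)))
      where
      ml-fractional = raised-midpoint-fractional {v = v} u∈box vl≡1 ul≢1
      mL-fractional = mid-fractional (proj₁ (u∈box L)) (proj₂ (u∈box L)) (proj₁ (v∈box L)) (proj₂ (v∈box L))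
                                     (inj₁ (proj₁ uL-fractional)) (inj₁ (proj₂ uL-fractional))
      v≡u : ∀ i → i ≢ l → i ≢ L → v i ≡ u i
      v≡u i i≢l i≢L = fractional-pair-fixes uv l≢L (W≢0 L) ml-fractional mL-fractional i≢l i≢L
      v-bits : ∀ i → i ≢ L → v i ≡ 0ℚ ⊎ v i ≡ 1ℚ
      v-bits i i≢L with i Fin.≟ l
      ... | yes refl = inj₂ vl≡1
      ... | no i≢l   = subst (λ q → q ≡ 0ℚ ⊎ q ≡ 1ℚ) (sym (v≡u i i≢l i≢L)) (u-bits i i≢L)
      all-bits : v L ≡ 0ℚ ⊎ v L ≡ 1ℚ → ∀ i → v i ≡ 0ℚ ⊎ v i ≡ 1ℚ
      all-bits vL-bit i with i Fin.≟ L
      ... | yes refl = vL-bit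
      ... | no i≢L   = v-bits i i≢L
      vL-fractional : Tight v → v L ≡ 0ℚ ⊎ v L ≡ 1ℚ ⊎ Fractional (v L) → Fractional (v L)
      vL-fractional v-tight (inj₁ vL≡0)        = ⊥-elim (not-tight-01 v (all-bits (inj₁ vL≡0)) v-tight)
      vL-fractional v-tight (inj₂ (inj₁ vL≡1)) = ⊥-elim (not-tight-01 v (all-bits (inj₂ vL≡1)) v-tight)
      vL-fractional v-tight (inj₂ (inj₂ frac)) = frac
      by-midpoint : dot W (midpoint u v) < R ⊎ Tight (midpoint u v) →
                    AlmostIntegral L v × (∀ i → i ≢ l → i ≢ L → v i ≡ u i)
      by-midpoint (inj₁ slack) =
        ⊥-elim (slack-endpoint-moves uv v-slack (subst Fractional (sym vL≡uL) uL-fractional) vL≡uL)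
        where
        vL≡uL : v L ≡ u L
        vL≡uL = slack-midpoint-fixes uv slack ml-fractional (l≢L ∘′ sym)
        v-slack : dot W v < R
        v-slack = mid<⇒< u-tight (subst (_< R) (dot-segment W u v ½) slack)
      by-midpoint (inj₂ m-tight) =
        (v-tight , v-bits , vL-fractional v-tight (unit-interval-cases (proj₁ (v∈box L)) (proj₂ (v∈box L)))) , v≡u
        where
        v-tight : Tight v
        v-tight = mid≡⇒≡ W·u≤R W·v≤R (trans (sym (dot-segment W u v ½)) m-tight)

true≢false : true ≢ false
true≢false ()

bit : Bool → ℚ
bit c = if c then 1ℚ else 0ℚ

bit-01 : ∀ c → bit c ≡ 0ℚ ⊎ bit c ≡ 1ℚ
bit-01 true  = inj₂ refl
bit-01 false = inj₁ refl

bit-in-unit : ∀ c → 0ℚ ≤ bit c × bit c ≤ 1ℚ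
bit-in-unit true  = <⇒≤ 0<1 , ≤-refl
bit-in-unit false = ≤-refl , <⇒≤ 0<1

0≤if : ∀ c {q} → 0ℚ ≤ q → 0ℚ ≤ (if c then q else 0ℚ)
0≤if true  0≤q = 0≤q
0≤if false _   = ≤-refl

count : ∀ {m} → (Fin m → Bool) → ℕ
count p = sumℕ (λ i → if p i then 1 else 0)

count-mono : ∀ {m} (p q : Fin m → Bool) → (∀ i → p i ≡ true → q i ≡ true) → count p ℕ.≤ count q
count-mono {zero}  p q p⊆q = ℕ.z≤n
count-mono {suc m} p q p⊆q with p Fin.zero in p0 | q Fin.zero in q0
... | true  | true  = ℕ.s≤s (count-mono (p ∘′ Fin.suc) (q ∘′ Fin.suc) (λ i → p⊆q (Fin.suc i)))
... | true  | false = ⊥-elim (true≢false (trans (sym (p⊆q Fin.zero p0)) q0))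
... | false | true  = ℕₚ.m≤n⇒m≤1+n (count-mono (p ∘′ Fin.suc) (q ∘′ Fin.suc) (λ i → p⊆q (Fin.suc i)))
... | false | false = count-mono (p ∘′ Fin.suc) (q ∘′ Fin.suc) (λ i → p⊆q (Fin.suc i))

count-≤-suc : ∀ {m} (p q : Fin m → Bool) →
              (∀ i j → i ≢ j → q i ≡ true → p i ≡ false → q j ≡ true → p j ≡ false → ⊥) →
              count q ℕ.≤ suc (count p)
count-≤-suc {zero}  p q one-new = ℕ.z≤n
count-≤-suc {suc m} p q one-new with q Fin.zero in q0 | p Fin.zero in p0
... | true  | true  = ℕ.s≤s (count-≤-suc (p ∘′ Fin.suc) (q ∘′ Fin.suc) tail-one-new)
  where tail-one-new = λ i j i≢j → one-new (Fin.suc i) (Fin.suc j) (i≢j ∘′ suc-injective)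
... | true  | false = ℕ.s≤s (count-mono (q ∘′ Fin.suc) (p ∘′ Fin.suc) q⊆p)
  where
  q⊆p : ∀ i → q (Fin.suc i) ≡ true → p (Fin.suc i) ≡ true
  q⊆p i qi with p (Fin.suc i) in pi
  ... | true  = refl
  ... | false = ⊥-elim (one-new Fin.zero (Fin.suc i) (λ ()) q0 p0 qi pi)
... | false | true  = ℕₚ.m≤n⇒m≤1+n (count-≤-suc (p ∘′ Fin.suc) (q ∘′ Fin.suc) tail-one-new)
  where tail-one-new = λ i j i≢j → one-new (Fin.suc i) (Fin.suc j) (i≢j ∘′ suc-injective)
... | false | false = count-≤-suc (p ∘′ Fin.suc) (q ∘′ Fin.suc) tail-one-new
  where tail-one-new = λ i j i≢j → one-new (Fin.suc i) (Fin.suc j) (i≢j ∘′ suc-injective)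

count-<⇒new : ∀ {m} (p q : Fin m → Bool) → count p ℕ.< count q → Σ (Fin m) λ i → q i ≡ true × p i ≡ false
count-<⇒new {suc m} p q p<q with q Fin.zero in q0 | p Fin.zero in p0
... | true  | false = Fin.zero , q0 , p0
... | true  | true  = Data.Product.map Fin.suc (λ h → h) (count-<⇒new (p ∘′ Fin.suc) (q ∘′ Fin.suc) (ℕₚ.≤-pred p<q))
... | false | false = Data.Product.map Fin.suc (λ h → h) (count-<⇒new (p ∘′ Fin.suc) (q ∘′ Fin.suc) p<q)
... | false | true  =
  Data.Product.map Fin.suc (λ h → h) (count-<⇒new (p ∘′ Fin.suc) (q ∘′ Fin.suc) (ℕₚ.<-trans (ℕₚ.n<1+n _) p<q))

count-none : ∀ {m} (p : Fin m → Bool) → (∀ i → p i ≡ false) → count p ≡ 0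
count-none {zero}  p none = refl
count-none {suc m} p none rewrite none Fin.zero = count-none (p ∘′ Fin.suc) (λ i → none (Fin.suc i))

count-cong : ∀ {m} {p q : Fin m → Bool} → (∀ i → p i ≡ q i) → count p ≡ count q
count-cong {zero}  p≗q = refl
count-cong {suc m} p≗q = cong₂ ℕ._+_ (cong (λ c → if c then 1 else 0) (p≗q Fin.zero)) (count-cong (λ i → p≗q (Fin.suc i)))

count-all-but-last : ∀ m → count (λ (i : Fin (suc m)) → not (does (i Fin.≟ Fin.fromℕ m))) ≡ m
count-all-but-last zero    = refl
count-all-but-last (suc m) = cong suc (count-all-but-last m)

count-partition : ∀ {m} (p : Fin m → Bool) → count p ℕ.+ count (not ∘′ p) ≡ m
count-partition {zero}  p = refl
count-partition {suc m} p with p Fin.zero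
... | true  = cong suc (count-partition (p ∘′ Fin.suc))
... | false = trans (ℕₚ.+-suc _ _) (cong suc (count-partition (p ∘′ Fin.suc)))

module _ {m : ℕ} where

  eS-tabulate : ∀ (σ : Fin m → Bool) i → eS (tabulate σ) i ≡ bit (σ i)
  eS-tabulate σ i = cong bit (lookup∘tabulate σ i)

  insert : (Fin m → Bool) → Fin m → Fin m → Bool
  insert σ l i = σ i ∨ does (i Fin.≟ l)

  insert-at : ∀ σ l → insert σ l l ≡ true
  insert-at σ l = trans (cong (σ l ∨_) (does-refl l)) (∨-zeroʳ (σ l))

  insert-off : ∀ σ {l i} → i ≢ l → insert σ l i ≡ σ i
  insert-off σ {i = i} i≢l = trans (cong (σ i ∨_) (does-≢ i≢l)) (∨-identityʳ (σ i))

  insert-mono : ∀ σ l {i} → σ i ≡ true → insert σ l i ≡ true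
  insert-mono σ l {i} σi≡true = cong (_∨ does (i Fin.≟ l)) σi≡true

  dot-insert : ∀ c σ {l} → σ l ≡ false → dot c (eS (tabulate (insert σ l))) ≡ dot c (eS (tabulate σ)) + c l
  dot-insert c σ {l} σl≡false = begin
    dot c (eS (tabulate (insert σ l)))           ≡⟨ dot-cong c split ⟩
    dot c (eS (tabulate σ) ⊕ δ l 1ℚ)              ≡⟨ dot-⊕ c _ _ ⟩
    dot c (eS (tabulate σ)) + dot c (δ l 1ℚ)
      ≡⟨ cong (dot c (eS (tabulate σ)) +_) (trans (dot-δ c l 1ℚ) (*-identityʳ (c l))) ⟩
    dot c (eS (tabulate σ)) + c l                 ∎
    where
    open ≡-Reasoning
    split : eS (tabulate (insert σ l)) ≐ (eS (tabulate σ) ⊕ δ l 1ℚ)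
    split i with i Fin.≟ l
    ... | yes refl = trans (eS-tabulate (insert σ i) i) (trans (cong bit (insert-at σ i))
                       (sym (trans (cong (_+ 1ℚ) (trans (eS-tabulate σ i) (cong bit σl≡false))) (+-identityˡ 1ℚ))))
    ... | no i≢l   = trans (eS-tabulate (insert σ l) i) (trans (cong bit (insert-off σ i≢l))
                       (sym (trans (cong (_+ 0ℚ) (eS-tabulate σ i)) (+-identityʳ _))))

insertIf : ∀ {m} → Bool → (Fin m → Bool) → Fin m → Fin m → Bool
insertIf true  σ l = insert σ l
insertIf false σ l = σ

insertIf-mono : ∀ {m} c (σ : Fin m → Bool) l {i} → σ i ≡ true → insertIf c σ l i ≡ true
insertIf-mono true  σ l σi≡true = insert-mono σ l σi≡true
insertIf-mono false σ l σi≡true = σi≡true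

insertIf-miss : ∀ {m} c (σ : Fin m → Bool) {l i} → σ i ≡ false → (c ≡ true → l ≢ i) → insertIf c σ l i ≡ false
insertIf-miss true  σ σi≡false l≢i = trans (insert-off σ (l≢i refl ∘′ sym)) σi≡false
insertIf-miss false σ σi≡false _   = σi≡false

sweep : ∀ {m k} → (Fin m → Bool) → (Fin k → Bool) → (Fin k → Fin m) → Fin m → Bool
sweep {k = zero}  σ p g = σ
sweep {k = suc k} σ p g = sweep (insertIf (p Fin.zero) σ (g Fin.zero)) (p ∘′ Fin.suc) (g ∘′ Fin.suc)

sweep-mono : ∀ {m k} σ (p : Fin k → Bool) (g : Fin k → Fin m) {i} → σ i ≡ true → sweep σ p g i ≡ true
sweep-mono {k = zero}  σ p g σi≡true = σi≡true
sweep-mono {k = suc k} σ p g σi≡true =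
  sweep-mono _ (p ∘′ Fin.suc) (g ∘′ Fin.suc) (insertIf-mono (p Fin.zero) σ (g Fin.zero) σi≡true)

sweep-hit : ∀ {m k} σ (p : Fin k → Bool) (g : Fin k → Fin m) j → p j ≡ true → sweep σ p g (g j) ≡ true
sweep-hit σ p g Fin.zero pj≡true =
  sweep-mono _ (p ∘′ Fin.suc) (g ∘′ Fin.suc)
    (subst (λ c → insertIf c σ (g Fin.zero) (g Fin.zero) ≡ true) (sym pj≡true) (insert-at σ (g Fin.zero)))
sweep-hit σ p g (Fin.suc j) pj≡true = sweep-hit _ (p ∘′ Fin.suc) (g ∘′ Fin.suc) j pj≡true

sweep-miss : ∀ {m k} σ (p : Fin k → Bool) (g : Fin k → Fin m) {i} → σ i ≡ false →
             (∀ j → p j ≡ true → g j ≢ i) → sweep σ p g i ≡ false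
sweep-miss {k = zero}  σ p g σi≡false _     = σi≡false
sweep-miss {k = suc k} σ p g σi≡false avoid =
  sweep-miss _ (p ∘′ Fin.suc) (g ∘′ Fin.suc)
    (insertIf-miss (p Fin.zero) σ σi≡false (avoid Fin.zero)) (λ j → avoid (Fin.suc j))

-- The polytope P_b

walk-++ : ∀ {d} {b : Fin d → ℕ} {x y z k k′} → Walk b x y k → Walk b y z k′ → Walk b x z (k ℕ.+ k′)
walk-++ here          walk′ = walk′
walk-++ (step e walk) walk′ = step e (walk-++ walk walk′)

pt-at : ∀ {d} (b : Fin d → ℕ) S k → pt b S k k ≡ (β b + ¼ - dot (w b) (eS S)) ÷′ w b k
pt-at b S k = cong (λ c → if c then (β b + ¼ - dot (w b) (eS S)) ÷′ w b k else eS S k) (does-refl k)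

pt-off : ∀ {d} (b : Fin d → ℕ) S {k i} → i ≢ k → pt b S k i ≡ eS S i
pt-off b S {k} {i} i≢k = cong (λ c → if c then (β b + ¼ - dot (w b) (eS S)) ÷′ w b k else eS S i) (does-≢ i≢k)

sumIn+sumOut : ∀ {m} (b : Fin m → ℕ) S → sumIn b S ℕ.+ sumOut b S ≡ sumℕ b
sumIn+sumOut b []          = refl
sumIn+sumOut b (true ∷ S)  = trans (ℕₚ.+-assoc (b Fin.zero) _ _) (cong (b Fin.zero ℕ.+_) (sumIn+sumOut (b ∘′ Fin.suc) S))
sumIn+sumOut b (false ∷ S) =
  trans (sym (ℕₚ.+-assoc (sumIn (b ∘′ Fin.suc) S) (b Fin.zero) _))
        (trans (cong (ℕ._+ sumOut (b ∘′ Fin.suc) S) (ℕₚ.+-comm (sumIn (b ∘′ Fin.suc) S) (b Fin.zero)))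
               (trans (ℕₚ.+-assoc (b Fin.zero) _ _) (cong (b Fin.zero ℕ.+_) (sumIn+sumOut (b ∘′ Fin.suc) S))))

-- Coordinates 1..d, d+1, d+2 of the paper are item j, P and lastI d.
module _ {d : ℕ} where

  item : Fin d → Fin (suc (suc d))
  item j = Fin.inject₁ (Fin.inject₁ j)

  P : Fin (suc (suc d))
  P = Fin.inject₁ (Fin.fromℕ d)

  toℕ-item : ∀ j → toℕ (item j) ≡ toℕ j
  toℕ-item j = trans (toℕ-inject₁ (Fin.inject₁ j)) (toℕ-inject₁ j)

  toℕ-P : toℕ P ≡ d
  toℕ-P = trans (toℕ-inject₁ (Fin.fromℕ d)) (toℕ-fromℕ d)

  toℕ-L : toℕ (lastI d) ≡ suc d
  toℕ-L = toℕ-fromℕ (suc d)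

  item-injective : ∀ {j k} → item j ≡ item k → j ≡ k
  item-injective {j} {k} e = toℕ-injective (trans (sym (toℕ-item j)) (trans (cong toℕ e) (toℕ-item k)))

  item≢P : ∀ j → item j ≢ P
  item≢P j e = ℕₚ.<-irrefl (trans (sym (toℕ-item j)) (trans (cong toℕ e) toℕ-P)) (toℕ<n j)

  item≢L : ∀ j → item j ≢ lastI d
  item≢L j e = ℕₚ.<-irrefl (trans (sym (toℕ-item j)) (trans (cong toℕ e) toℕ-L)) (ℕₚ.m<n⇒m<1+n (toℕ<n j))

  P≢L : P ≢ lastI d
  P≢L e = ℕₚ.1+n≢n (sym (trans (sym toℕ-P) (trans (cong toℕ e) toℕ-L)))

  data Coordinate : Fin (suc (suc d)) → Set where
    item-coordinate : ∀ j → Coordinate (item j)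
    P-coordinate    : Coordinate P
    L-coordinate    : Coordinate (lastI d)

  coordinate : ∀ i → Coordinate i
  coordinate i with toℕ i ℕ.<? d
  ... | yes i<d = subst Coordinate (toℕ-injective (trans (toℕ-item _) (toℕ-fromℕ< i<d))) (item-coordinate (fromℕ< i<d))
  ... | no i≮d with toℕ i ℕ.≟ d
  ...   | yes i≡d = subst Coordinate (toℕ-injective (trans toℕ-P (sym i≡d))) P-coordinate
  ...   | no i≢d  = subst Coordinate (toℕ-injective (trans toℕ-L (sym i≡1+d))) L-coordinate
    where
    i≡1+d : toℕ i ≡ suc d
    i≡1+d = ℕₚ.≤-antisym (ℕₚ.≤-pred (toℕ<n i)) (ℕₚ.≤∧≢⇒< (ℕₚ.≮⇒≥ i≮d) (i≢d ∘′ sym))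

  first : Fin (suc (suc d)) → Bool
  first i = toℕ i ℕ.<ᵇ suc d

  first-item : ∀ j → first (item j) ≡ true
  first-item j = Equivalence.to T-≡ (ℕₚ.<⇒<ᵇ (subst (ℕ._< suc d) (sym (toℕ-item j)) (ℕₚ.m<n⇒m<1+n (toℕ<n j))))

  first-P : first P ≡ true
  first-P = Equivalence.to T-≡ (ℕₚ.<⇒<ᵇ (subst (ℕ._< suc d) (sym toℕ-P) (ℕₚ.n<1+n d)))

  first-L : first (lastI d) ≡ false
  first-L with first (lastI d) in eq
  ... | false = refl
  ... | true  = ⊥-elim (ℕₚ.<-irrefl toℕ-L (ℕₚ.<ᵇ⇒< (toℕ (lastI d)) (suc d) (subst T (sym eq) tt)))

  first-off-L : ∀ {i} → i ≢ lastI d → first i ≡ true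
  first-off-L {i} i≢L with coordinate i
  ... | item-coordinate j = first-item j
  ... | P-coordinate      = first-P
  ... | L-coordinate      = ⊥-elim (i≢L refl)

  sumℚ-coordinates : ∀ (f : Fin (suc (suc d)) → ℚ) → sumℚ f ≡ sumℚ (f ∘′ item) + f P + f (lastI d)
  sumℚ-coordinates f = trans (sumℚ-last f) (cong (_+ f (lastI d)) (sumℚ-last (f ∘′ Fin.inject₁)))

module _ {d : ℕ} (b : Fin d → ℕ) where

  open Polytope (w b) (β b + ¼)

  w-item : ∀ j → w b (item j) ≡ ι (b j)
  w-item j with toℕ (item j) ℕ.<? d
  ... | yes p = cong (λ k → ι (b k)) (toℕ-injective (trans (toℕ-fromℕ< p) (toℕ-item j)))
  ... | no ¬p = ⊥-elim (¬p (subst (ℕ._< d) (sym (toℕ-item j)) (toℕ<n j)))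

  w-P : w b P ≡ - β b
  w-P with toℕ (P {d}) ℕ.<? d
  ... | yes p = ⊥-elim (ℕₚ.<-irrefl toℕ-P p)
  ... | no _ with toℕ (P {d}) ℕ.≟ d
  ...   | yes _   = refl
  ...   | no P≢d  = ⊥-elim (P≢d toℕ-P)

  w-L : w b (lastI d) ≡ β b + ½
  w-L with toℕ (lastI d) ℕ.<? d
  ... | yes p = ⊥-elim (ℕₚ.<-irrefl refl (ℕₚ.<-trans (subst (ℕ._< d) toℕ-L p) (ℕₚ.n<1+n d)))
  ... | no _ with toℕ (lastI d) ℕ.≟ d
  ...   | yes L≡d = ⊥-elim (ℕₚ.1+n≢n (trans (sym toℕ-L) L≡d))
  ...   | no _    = refl

  β+β≡ι : β b + β b ≡ ι (sumℕ b)
  β+β≡ι = s+s≡ι (sumℕ b)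

  0≤β : 0ℚ ≤ β b
  0≤β = ≤-from-diff (½ * (β b + β b)) (0≤* (<⇒≤ 0<½) (subst (0ℚ ≤_) (sym β+β≡ι) (0≤ι (sumℕ b)))) (eq (β b))
    where eq : ∀ x → x - 0ℚ ≡ ½ * (x + x)
          eq = solve-∀ ringℚ

  0<β : 0 ℕ.< sumℕ b → 0ℚ < β b
  0<β 0<Σb = <-from-diff (½ * (β b + β b)) (0<* 0<½ (subst (0ℚ <_) (sym β+β≡ι) (0<ι 0<Σb))) (eq (β b))
    where eq : ∀ x → x - 0ℚ ≡ ½ * (x + x)
          eq = solve-∀ ringℚ

  0<wL : 0ℚ < w b (lastI d)
  0<wL = subst (0ℚ <_) (sym (trans w-L (+-comm (β b) ½))) (0<+ 0<½ 0≤β)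

  wL≢0 : w b (lastI d) ≢ 0ℚ
  wL≢0 = <⇒≢ 0<wL ∘′ sym

  w≢0 : 0 ℕ.< sumℕ b → (∀ j → 0 ℕ.< b j) → ∀ i → w b i ≢ 0ℚ
  w≢0 0<Σb 0<b i with coordinate i
  ... | item-coordinate j = subst (_≢ 0ℚ) (sym (w-item j)) (<⇒≢ (0<ι (0<b j)) ∘′ sym)
  ... | P-coordinate      = subst (_≢ 0ℚ) (sym w-P) (λ -β≡0 → <⇒≢ (0<β 0<Σb) (sym (trans (eq (β b)) (cong -_ -β≡0))))
    where eq : ∀ x → x ≡ - (- x)
          eq = solve-∀ ringℚ
  ... | L-coordinate      = wL≢0

  not-tight-01 : ∀ x → (∀ i → x i ≡ 0ℚ ⊎ x i ≡ 1ℚ) → ¬ Tight x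
  not-tight-01 x x-bits W·x≡R = R-not-half (subst HalfIntegral W·x≡R
    (halfIntegral-sum (λ i → w b i * x i) (λ i → halfIntegral-*bit {w b i} (w-half i) (x-bits i))))
    where
    s = sumℕ b
    w-half : ∀ i → HalfIntegral (w b i)
    w-half i with coordinate i
    ... | item-coordinate j = subst HalfIntegral (sym (w-item j))
                                (b j ℕ.+ b j , 0 , trans (sym (ι-+ (b j) (b j))) (sym (+-identityʳ _)))
    ... | P-coordinate      = subst HalfIntegral (sym w-P) (0 , s , trans (eq (β b)) (cong (λ q → 0ℚ - q) β+β≡ι))
      where eq : ∀ x → - x + - x ≡ 0ℚ - (x + x)
            eq = solve-∀ ringℚ
    ... | L-coordinate      = subst HalfIntegral (sym w-L)
                                (s ℕ.+ 1 , 0 , trans (eq (β b)) (trans (cong (_+ 1ℚ) β+β≡ι)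
                                                 (trans (sym (ι-+ s 1)) (sym (+-identityʳ _)))))
      where eq : ∀ x → (x + ½) + (x + ½) ≡ (x + x) + 1ℚ
            eq = solve-∀ ringℚ
    R-not-half : ¬ HalfIntegral (β b + ¼)
    R-not-half (a , c , 2R≡) = ι≢ι+½ a (s ℕ.+ c) (sym (begin
      ι (s ℕ.+ c) + ½           ≡⟨ cong (_+ ½) (ι-+ s c) ⟩
      ι s + ι c + ½             ≡⟨ eq₁ (ι s) (ι c) ⟩
      (ι s + ½) + ι c           ≡⟨ cong (_+ ι c) (trans (cong (_+ ½) (sym β+β≡ι)) (trans (eq₂ (β b)) 2R≡)) ⟩
      ι a - ι c + ι c           ≡⟨ eq₃ (ι a) (ι c) ⟩
      ι a                       ∎))
      where
      open ≡-Reasoning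
      eq₁ : ∀ x y → x + y + ½ ≡ (x + ½) + y
      eq₁ = solve-∀ ringℚ
      eq₂ : ∀ x → (x + x) + ½ ≡ (x + ¼) + (x + ¼)
      eq₂ = solve-∀ ringℚ
      eq₃ : ∀ x y → x - y + y ≡ x
      eq₃ = solve-∀ ringℚ

  -- point σ is the paper's (σ, d+2), and load σ = Σ_{i∈σ} w_i.
  load : (Fin (suc (suc d)) → Bool) → ℚ
  load σ = dot (w b) (eS (tabulate σ))

  point : (Fin (suc (suc d)) → Bool) → Vecℚ (suc (suc d))
  point σ = pt b (tabulate σ) (lastI d)

  Admissible : (Fin (suc (suc d)) → Bool) → Set
  Admissible σ = σ (lastI d) ≡ false × 0ℚ ≤ load σ × load σ ≤ β b

  point-off : ∀ σ {i} → i ≢ lastI d → point σ i ≡ bit (σ i)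
  point-off σ i≢L = trans (pt-off b (tabulate σ) i≢L) (eS-tabulate σ _)

  point-L : ∀ σ → point σ (lastI d) * w b (lastI d) ≡ β b + ¼ - load σ
  point-L σ = trans (cong (_* w b (lastI d)) (pt-at b (tabulate σ) (lastI d))) (p÷′q*q≡p _ _ wL≢0)

  point-tight : ∀ σ → σ (lastI d) ≡ false → Tight (point σ)
  point-tight σ σL≡false = begin
    dot (w b) (point σ)                                 ≡⟨ dot-cong (w b) split ⟩
    dot (w b) (eS (tabulate σ) ⊕ δ (lastI d) yL)        ≡⟨ dot-⊕ (w b) (eS (tabulate σ)) (δ (lastI d) yL) ⟩
    load σ + dot (w b) (δ (lastI d) yL)
      ≡⟨ cong (load σ +_) (trans (dot-δ (w b) _ yL) (*-comm (w b (lastI d)) yL)) ⟩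
    load σ + yL * w b (lastI d)                         ≡⟨ cong (load σ +_) (point-L σ) ⟩
    load σ + (β b + ¼ - load σ)                         ≡⟨ eq (load σ) (β b + ¼) ⟩
    β b + ¼                                             ∎
    where
    open ≡-Reasoning
    yL = point σ (lastI d)
    eq : ∀ a r → a + (r - a) ≡ r
    eq = solve-∀ ringℚ
    split-at : ∀ i → Dec (i ≡ lastI d) → point σ i ≡ eS (tabulate σ) i + δ (lastI d) yL i
    split-at i (yes refl) =
      sym (trans (cong₂ _+_ (trans (eS-tabulate σ i) (cong bit σL≡false)) (δ-at i yL)) (+-identityˡ yL))
    split-at i (no i≢L)   =
      trans (pt-off b (tabulate σ) i≢L) (sym (trans (cong (eS (tabulate σ) i +_) (δ-off yL i≢L)) (+-identityʳ _)))
    split : point σ ≐ (eS (tabulate σ) ⊕ δ (lastI d) yL)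
    split i = split-at i (i Fin.≟ lastI d)

  -- The last coordinate is (β + ¼ - load σ) / (β + ½), and 0 ≤ load σ ≤ β.
  point-L-fractional : ∀ {σ} → Admissible σ → Fractional (point σ (lastI d))
  point-L-fractional {σ} (_ , 0≤load , load≤β) =
    *-cancelʳ-<-nonNeg (w b (lastI d)) {{nonNegative (<⇒≤ 0<wL)}}
      (subst₂ _<_ (sym (*-zeroˡ (w b (lastI d)))) (sym (point-L σ))
                  (<-from-diff _ (0<+ 0<¼ (0≤-diff load≤β)) (eq₀ (β b) (load σ)))) ,
    *-cancelʳ-<-nonNeg (w b (lastI d)) {{nonNegative (<⇒≤ 0<wL)}}
      (subst₂ _<_ (sym (point-L σ)) (sym (trans (*-identityˡ (w b (lastI d))) w-L))
                  (<-from-diff _ (0<+ 0<¼ 0≤load) (eq₁ (β b) (load σ))))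
    where
    eq₀ : ∀ x e → x + ¼ - e - 0ℚ ≡ ¼ + (x - e)
    eq₀ = solve-∀ ringℚ
    eq₁ : ∀ x e → x + ½ - (x + ¼ - e) ≡ ¼ + e
    eq₁ = solve-∀ ringℚ

  point-almost-integral : ∀ {σ} → Admissible σ → AlmostIntegral (lastI d) (point σ)
  point-almost-integral {σ} adm@(σL≡false , _) =
    point-tight σ σL≡false , (λ i i≢L → subst (λ q → q ≡ 0ℚ ⊎ q ≡ 1ℚ) (sym (point-off σ i≢L)) (bit-01 (σ i))) ,
    point-L-fractional {σ} adm

  point-feasible : ∀ {σ} → Admissible σ → Feasible (point σ)
  point-feasible {σ} adm@(σL≡false , _) = box , ≤-reflexive (point-tight σ σL≡false)
    where
    box-at : ∀ i → Dec (i ≡ lastI d) → 0ℚ ≤ point σ i × point σ i ≤ 1ℚ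
    box-at i (yes refl) = <⇒≤ (proj₁ (point-L-fractional {σ} adm)) , <⇒≤ (proj₂ (point-L-fractional {σ} adm))
    box-at i (no i≢L)   = subst (λ q → 0ℚ ≤ q × q ≤ 1ℚ) (sym (point-off σ i≢L)) (bit-in-unit (σ i))
    box : InBox (point σ)
    box i = box-at i (i Fin.≟ lastI d)

  point-vertex : ∀ {σ} → Admissible σ → Vertex (point σ)
  point-vertex {σ} adm =
    pinned-vertex wL≢0 (point-feasible {σ} adm) (proj₁ almost) (proj₁ (proj₂ almost))
    where almost = point-almost-integral {σ} adm

  point-edge : ∀ {σ l} → Admissible σ → Admissible (insert σ l) → σ l ≡ false → l ≢ lastI d →
               Edge (point σ) (point (insert σ l))
  point-edge {σ} {l} adm adm′ σl≡false l≢L =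
    pinned-edge wL≢0 (point-feasible {σ} adm) (point-feasible {insert σ l} adm′)
      (proj₁ almost) (point-tight (insert σ l) (proj₁ adm′))
      (λ i i≢L _ → proj₁ (proj₂ almost) i i≢L)
      (λ i i≢L i≢l → trans (point-off (insert σ l) i≢L) (trans (cong bit (insert-off σ i≢l)) (sym (point-off σ i≢L))))
      (trans (point-off σ l≢L) (cong bit σl≡false))
      (trans (point-off (insert σ l) l≢L) (cong bit (insert-at σ l)))
    where almost = point-almost-integral {σ} adm

  gain : ∀ {k} → (Fin k → Bool) → (Fin k → Fin (suc (suc d))) → ℚ
  gain p g = sumℚ (λ j → if p j then w b (g j) else 0ℚ)

  insertIf-walk : ∀ c σ {l} → l ≢ lastI d → (c ≡ true → σ l ≡ false) → Admissible σ →
                  Admissible (insertIf c σ l) →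
                  Walk b (point σ) (point (insertIf c σ l)) (if c then 1 else 0)
  insertIf-walk false σ _   _     _   _    = here
  insertIf-walk true  σ {l} l≢L fresh adm adm′ = step (point-edge {σ} {l} adm adm′ (fresh refl) l≢L) here

  load-insertIf : ∀ c σ {l} → (c ≡ true → σ l ≡ false) → load (insertIf c σ l) ≡ load σ + (if c then w b l else 0ℚ)
  load-insertIf false σ _     = sym (+-identityʳ (load σ))
  load-insertIf true  σ fresh = dot-insert (w b) σ (fresh refl)

  -- The load only grows along the sweep, so every intermediate mask stays admissible.
  sweep-walk : ∀ {k} σ (p : Fin k → Bool) (g : Fin k → Fin (suc (suc d))) →
               (∀ {j j′} → g j ≡ g j′ → j ≡ j′) → (∀ j → g j ≢ lastI d) → (∀ j → 0ℚ ≤ w b (g j)) →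
               (∀ j → p j ≡ true → σ (g j) ≡ false) → Admissible σ → load σ + gain p g ≤ β b →
               Walk b (point σ) (point (sweep σ p g)) (count p) ×
               load (sweep σ p g) ≡ load σ + gain p g × sweep σ p g (lastI d) ≡ false
  sweep-walk {zero}  σ p g _ _ _ _ adm _ = here , sym (+-identityʳ (load σ)) , proj₁ adm
  sweep-walk {suc k} σ p g g-injective g≢L 0≤wg fresh adm@(σL≡false , 0≤load , _) load+gain≤β =
    walk-++ (insertIf-walk c σ (g≢L Fin.zero) (fresh Fin.zero) adm adm′) (proj₁ tail) ,
    trans (proj₁ (proj₂ tail)) (trans (cong (_+ rest) (load-insertIf c σ (fresh Fin.zero))) (+-assoc (load σ) h rest)) ,
    proj₂ (proj₂ tail)
    where
    c = p Fin.zero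
    l = g Fin.zero
    h = if c then w b l else 0ℚ
    rest = gain (p ∘′ Fin.suc) (g ∘′ Fin.suc)
    σ′ = insertIf c σ l
    0≤rest : 0ℚ ≤ rest
    0≤rest = subst (_≤ rest) (sumℚ-zero {k}) (sumℚ-mono (λ j → 0≤if (p (Fin.suc j)) (0≤wg (Fin.suc j))))
    load′≡ : load σ′ ≡ load σ + h
    load′≡ = load-insertIf c σ (fresh Fin.zero)
    load′+rest≤β : load σ′ + rest ≤ β b
    load′+rest≤β = subst (_≤ β b) (trans (sym (+-assoc (load σ) h rest)) (cong (_+ rest) (sym load′≡))) load+gain≤β
    adm′ : Admissible σ′
    adm′ = insertIf-miss c σ σL≡false (λ _ → g≢L Fin.zero) ,
           subst (0ℚ ≤_) (sym load′≡) (0≤+ 0≤load (0≤if c (0≤wg Fin.zero))) ,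
           ≤-trans (≤-from-diff rest 0≤rest (eq (load σ′) rest)) load′+rest≤β
      where eq : ∀ a r → a + r - a ≡ r
            eq = solve-∀ ringℚ
    fresh′ : ∀ j → p (Fin.suc j) ≡ true → σ′ (g (Fin.suc j)) ≡ false
    fresh′ j pj≡true = insertIf-miss c σ (fresh (Fin.suc j) pj≡true) (λ _ e → 0≢1+n (g-injective e))
    tail = sweep-walk σ′ (p ∘′ Fin.suc) (g ∘′ Fin.suc) (suc-injective ∘′ g-injective) (λ j → g≢L (Fin.suc j))
                      (λ j → 0≤wg (Fin.suc j)) fresh′ adm′ load′+rest≤β

  load-∅ : load (λ _ → false) ≡ 0ℚ
  load-∅ = trans (sumℚ-cong (λ i → trans (cong (w b i *_) (eS-tabulate (λ _ → false) i)) (*-zeroʳ (w b i))))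
                 (sumℚ-zero {suc (suc d)})

  load-first : load first ≡ β b
  load-first = begin
    load first                                            ≡⟨ sumℚ-coordinates (λ i → w b i * e i) ⟩
    sumℚ (λ j → w b (item j) * e (item j)) + w b P * e P + w b L * e L
      ≡⟨ cong₃ (λ x y z → x + w b P * y + w b L * z) (sumℚ-cong items) eP eL ⟩
    sumℚ (λ j → ι (b j)) + w b P * 1ℚ + w b L * 0ℚ        ≡⟨ cong₂ (λ x y → x + y * 1ℚ + w b L * 0ℚ) (ι-sum b) w-P ⟩
    ι (sumℕ b) + (- β b) * 1ℚ + w b L * 0ℚ                ≡⟨ cong (λ x → x + (- β b) * 1ℚ + w b L * 0ℚ) (sym β+β≡ι) ⟩
    (β b + β b) + (- β b) * 1ℚ + w b L * 0ℚ               ≡⟨ eq (β b) (w b L) ⟩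
    β b                                                   ∎
    where
    open ≡-Reasoning
    L = lastI d
    e = eS (tabulate (first {d}))
    cong₃ : ∀ (f : ℚ → ℚ → ℚ → ℚ) {x x′ y y′ z z′} → x ≡ x′ → y ≡ y′ → z ≡ z′ → f x y z ≡ f x′ y′ z′
    cong₃ f refl refl refl = refl
    items : ∀ j → w b (item j) * e (item j) ≡ ι (b j)
    items j = trans (cong (w b (item j) *_) (trans (eS-tabulate first (item j)) (cong bit (first-item j))))
                    (trans (*-identityʳ _) (w-item j))
    eP : e P ≡ 1ℚ
    eP = trans (eS-tabulate first (P {d})) (cong bit (first-P {d}))
    eL : e L ≡ 0ℚ
    eL = trans (eS-tabulate first L) (cong bit (first-L {d}))
    eq : ∀ x y → (x + x) + (- x) * 1ℚ + y * 0ℚ ≡ x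
    eq = solve-∀ ringℚ

  ∅-admissible : Admissible (λ _ → false)
  ∅-admissible = refl , ≤-reflexive (sym load-∅) , subst (_≤ β b) (sym load-∅) 0≤β

  first-admissible : Admissible first
  first-admissible = first-L {d} , subst (0ℚ ≤_) (sym load-first) 0≤β , ≤-reflexive load-first

  gain-in : ∀ S → gain (lookup S) item ≡ ι (sumIn b S)
  gain-in S = trans (sumℚ-cong (λ j → term (lookup S j) j)) (ι-sum (λ j → if lookup S j then b j else 0))
    where term : ∀ c j → (if c then w b (item j) else 0ℚ) ≡ ι (if c then b j else 0)
          term true  j = w-item j
          term false j = refl

  gain-out : ∀ S → gain (not ∘′ lookup S) item ≡ ι (sumOut b S)
  gain-out S = trans (sumℚ-cong (λ j → term (lookup S j) j)) (ι-sum (λ j → if lookup S j then 0 else b j))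
    where term : ∀ c j → (if not c then w b (item j) else 0ℚ) ≡ ι (if c then 0 else b j)
          term true  j = refl
          term false j = w-item j

  balanced⇒ι≡β : ∀ S → sumIn b S ≡ sumOut b S → ι (sumIn b S) ≡ β b
  balanced⇒ι≡β S balanced = x+x≡y+y⇒x≡y (begin
    ι (sumIn b S) + ι (sumIn b S)          ≡⟨ sym (ι-+ (sumIn b S) (sumIn b S)) ⟩
    ι (sumIn b S ℕ.+ sumIn b S)            ≡⟨ cong (λ n → ι (sumIn b S ℕ.+ n)) balanced ⟩
    ι (sumIn b S ℕ.+ sumOut b S)           ≡⟨ cong ι (sumIn+sumOut b S) ⟩
    ι (sumℕ b)                             ≡⟨ sym β+β≡ι ⟩
    β b + β b                              ∎)
    where open ≡-Reasoning

  half-sweep : ∀ σ (q : Fin d → Bool) → (∀ j → q j ≡ true → σ (item j) ≡ false) →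
               Admissible σ → load σ ≡ 0ℚ → gain q item ≡ β b →
               Walk b (point σ) (point (sweep σ q item)) (count q) × Admissible (sweep σ q item) ×
               load (sweep σ q item) ≡ β b
  half-sweep σ q fresh adm load≡0 gain≡β =
    proj₁ swept , (proj₂ (proj₂ swept) , subst (0ℚ ≤_) (sym load≡β) 0≤β , ≤-reflexive load≡β) , load≡β
    where
    load+gain≡β : load σ + gain q item ≡ β b
    load+gain≡β = trans (cong₂ _+_ load≡0 gain≡β) (+-identityˡ (β b))
    swept = sweep-walk σ q item item-injective item≢L (λ j → subst (0ℚ ≤_) (sym (w-item j)) (0≤ι (b j)))
                       fresh adm (≤-reflexive load+gain≡β)
    load≡β = trans (proj₁ (proj₂ swept)) load+gain≡β

  -- Insert the items of S, then P (whose weight -β cancels them), then the remaining items.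
  balanced⇒walk : ∀ S → sumIn b S ≡ sumOut b S → DistLe b (point (λ _ → false)) (point first) (suc d)
  balanced⇒walk S balanced =
    suc d , ℕₚ.≤-refl ,
    subst₂ (Walk b (point σ₀)) (cong (λ S′ → pt b S′ (lastI d)) (tabulate-cong σ₃≗first)) length≡
      (walk-++ (proj₁ phase₁) (step (point-edge {σ₁} {P} adm₁ adm₂ σ₁P≡false P≢L) (proj₁ phase₂)))
    where
    p = lookup S
    σ₀ : Fin (suc (suc d)) → Bool
    σ₀ _ = false
    ι-in≡β = balanced⇒ι≡β S balanced
    phase₁ = half-sweep σ₀ p (λ _ _ → refl) ∅-admissible load-∅ (trans (gain-in S) ι-in≡β)
    σ₁ = sweep σ₀ p item
    adm₁ = proj₁ (proj₂ phase₁)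
    σ₁P≡false : σ₁ P ≡ false
    σ₁P≡false = sweep-miss σ₀ p item refl (λ j _ → item≢P j)
    σ₂ = insert σ₁ P
    load₂ : load σ₂ ≡ 0ℚ
    load₂ = trans (dot-insert (w b) σ₁ σ₁P≡false) (trans (cong₂ _+_ (proj₂ (proj₂ phase₁)) w-P) (+-inverseʳ (β b)))
    adm₂ : Admissible σ₂
    adm₂ = trans (insert-off σ₁ (P≢L ∘′ sym)) (proj₁ adm₁) , ≤-reflexive (sym load₂) , subst (_≤ β b) (sym load₂) 0≤β
    fresh₂ : ∀ j → not (p j) ≡ true → σ₂ (item j) ≡ false
    fresh₂ j ¬pj = trans (insert-off σ₁ (item≢P j)) (sweep-miss σ₀ p item refl avoid)
      where avoid : ∀ j′ → p j′ ≡ true → item j′ ≢ item j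
            avoid j′ pj′ e = true≢false (sym (subst (λ c → not c ≡ true) (trans (cong p (sym (item-injective e))) pj′) ¬pj))
    phase₂ = half-sweep σ₂ (not ∘′ p) fresh₂ adm₂ load₂ (trans (gain-out S) (trans (cong ι (sym balanced)) ι-in≡β))
    σ₃ = sweep σ₂ (not ∘′ p) item
    reached : ∀ j c → p j ≡ c → σ₃ (item j) ≡ true
    reached j true  pj = sweep-mono σ₂ (not ∘′ p) item (insert-mono σ₁ P (sweep-hit σ₀ p item j pj))
    reached j false pj = sweep-hit σ₂ (not ∘′ p) item j (cong not pj)
    σ₃≗first : ∀ i → σ₃ i ≡ first i
    σ₃≗first i with coordinate i
    ... | item-coordinate j = trans (reached j (p j) refl) (sym (first-item j))
    ... | P-coordinate      = trans (sweep-mono σ₂ (not ∘′ p) item (insert-at σ₁ P)) (sym (first-P {d}))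
    ... | L-coordinate      = trans (proj₁ (proj₁ (proj₂ phase₂))) (sym (first-L {d}))
    length≡ : count p ℕ.+ suc (count (not ∘′ p)) ≡ suc d
    length≡ = trans (ℕₚ.+-suc _ _) (cong suc (count-partition p))

  items-load-tight : ∀ (x : Vecℚ (suc (suc d))) → Tight x →
                     sumℚ (λ j → w b (item j) * x (item j)) ≡ β b + ¼ - (- β b) * x P - (β b + ½) * x (lastI d)
  items-load-tight x x-tight = x+a+c≡r⇒x≡r-a-c (begin
    sumℚ (λ j → w b (item j) * x (item j)) + (- β b) * x P + (β b + ½) * x (lastI d)
      ≡⟨ cong₂ (λ p q → sumℚ (λ j → w b (item j) * x (item j)) + p * x P + q * x (lastI d)) (sym w-P) (sym w-L) ⟩
    sumℚ (λ j → w b (item j) * x (item j)) + w b P * x P + w b (lastI d) * x (lastI d)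
      ≡⟨ sym (sumℚ-coordinates (λ i → w b i * x i)) ⟩
    dot (w b) x
      ≡⟨ x-tight ⟩
    β b + ¼ ∎)
    where open ≡-Reasoning

  items-load-bits : ∀ (x : Vecℚ (suc (suc d))) → (∀ j → x (item j) ≡ 0ℚ ⊎ x (item j) ≡ 1ℚ) →
                    sumℚ (λ j → w b (item j) * x (item j)) ≡ ι (sumIn b (tabulate (λ j → does (x (item j) ≟ 1ℚ))))
  items-load-bits x x-bits =
    trans (sumℚ-cong term) (ι-sum (λ j → if lookup (tabulate (λ k → does (x (item k) ≟ 1ℚ))) j then b j else 0))
    where
    term : ∀ j → w b (item j) * x (item j) ≡ ι (if lookup (tabulate (λ k → does (x (item k) ≟ 1ℚ))) j then b j else 0)
    term j = trans (by-bit (x (item j) ≟ 1ℚ) (x-bits j))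
                   (cong (λ c → ι (if c then b j else 0)) (sym (lookup∘tabulate (λ k → does (x (item k) ≟ 1ℚ)) j)))
      where
      by-bit : (dec : Dec (x (item j) ≡ 1ℚ)) → x (item j) ≡ 0ℚ ⊎ x (item j) ≡ 1ℚ →
               w b (item j) * x (item j) ≡ ι (if does dec then b j else 0)
      by-bit (yes xj≡1) _           = trans (cong (w b (item j) *_) xj≡1) (trans (*-identityʳ _) (w-item j))
      by-bit (no _)     (inj₁ xj≡0) = trans (cong (w b (item j) *_) xj≡0) (*-zeroʳ (w b (item j)))
      by-bit (no xj≢1)  (inj₂ xj≡1) = ⊥-elim (xj≢1 xj≡1)

  -- A step of the walk that raises the coordinate P pins down β = Σ_{j∈S} b_j: the last
  -- coordinate of both endpoints is strictly between 0 and 1.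
  crossing-balanced : ∀ {u v} → AlmostIntegral (lastI d) u → AlmostIntegral (lastI d) v → u P ≡ 0ℚ → v P ≡ 1ℚ →
                      (∀ j → v (item j) ≡ u (item j)) → ∃ λ (S : Subset d) → sumIn b S ≡ sumOut b S
  crossing-balanced {u} {v} (u-tight , u-bits , 0<uL , _) (v-tight , _ , _ , vL<1) uP≡0 vP≡1 v≡u =
    S , sym (ℕₚ.+-cancelˡ-≡ N _ _ (trans (sumIn+sumOut b S) (sym 2N≡s)))
    where
    L = lastI d
    S : Subset d
    S = tabulate (λ j → does (u (item j) ≟ 1ℚ))
    N = sumIn b S
    X = sumℚ (λ j → w b (item j) * u (item j))
    X-from-u : X ≡ β b + ¼ - (- β b) * 0ℚ - (β b + ½) * u L
    X-from-u = subst (λ t → X ≡ β b + ¼ - (- β b) * t - (β b + ½) * u L) uP≡0 (items-load-tight u u-tight)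
    X-from-v : X ≡ β b + ¼ - (- β b) * 1ℚ - (β b + ½) * v L
    X-from-v = subst (λ t → X ≡ β b + ¼ - (- β b) * t - (β b + ½) * v L) vP≡1
                 (trans (sumℚ-cong λ j → cong (w b (item j) *_) (sym (v≡u j))) (items-load-tight v v-tight))
    0<c : ∀ {y} → 0ℚ < y → 0ℚ < (β b + ½) * y + (β b + ½) * y
    0<c 0<y = 0<+ (0<* (subst (0ℚ <_) w-L 0<wL) 0<y) (<⇒≤ (0<* (subst (0ℚ <_) w-L 0<wL) 0<y))
    ι2N≡X+X : ι (N ℕ.+ N) ≡ X + X
    ι2N≡X+X = trans (ι-+ N N) (sym (cong₂ _+_ X≡ιN X≡ιN))
      where X≡ιN : X ≡ ι N
            X≡ιN = items-load-bits u (λ j → u-bits (item j) (item≢L j))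
    2N<s+½ : ι (N ℕ.+ N) < ι (sumℕ b) + ½
    2N<s+½ = subst₂ _<_ (sym ι2N≡X+X) (cong (_+ ½) β+β≡ι)
               (<-from-diff _ (0<c 0<uL) (trans (cong (λ x → β b + β b + ½ - (x + x)) X-from-u) (eq (β b) (u L))))
      where eq : ∀ x y → x + x + ½ - ((x + ¼ - (- x) * 0ℚ - (x + ½) * y) + (x + ¼ - (- x) * 0ℚ - (x + ½) * y))
                         ≡ (x + ½) * y + (x + ½) * y
            eq = solve-∀ ringℚ
    s<2N+½ : ι (sumℕ b) < ι (N ℕ.+ N) + ½
    s<2N+½ = subst₂ _<_ β+β≡ι (cong (_+ ½) (sym ι2N≡X+X))
               (<-from-diff _ (0<c (0<-diff vL<1))
                  (trans (cong (λ x → x + x + ½ - (β b + β b)) X-from-v) (eq (β b) (v L))))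
      where eq : ∀ x y → (x + ¼ - (- x) * 1ℚ - (x + ½) * y) + (x + ¼ - (- x) * 1ℚ - (x + ½) * y) + ½ - (x + x)
                         ≡ (x + ½) * (1ℚ - y) + (x + ½) * (1ℚ - y)
            eq = solve-∀ ringℚ
    2N≡s : N ℕ.+ N ≡ sumℕ b
    2N≡s = ℕₚ.≤-antisym (ι<ι+½⇒≤ 2N<s+½) (ι<ι+½⇒≤ s<2N+½)

  atOne : Vecℚ (suc (suc d)) → Fin (suc (suc d)) → Bool
  atOne x i = not (does (i Fin.≟ lastI d)) ∧ does (x i ≟ 1ℚ)

  atOne-true : ∀ x {i} → atOne x i ≡ true → i ≢ lastI d × x i ≡ 1ℚ
  atOne-true x {i} e with i Fin.≟ lastI d | x i ≟ 1ℚ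
  ... | no i≢L | yes xi≡1 = i≢L , xi≡1
  ... | yes _  | _        = ⊥-elim (true≢false (sym e))
  ... | no _   | no _     = ⊥-elim (true≢false (sym e))

  atOne-false : ∀ x {i} → i ≢ lastI d → atOne x i ≡ false → x i ≢ 1ℚ
  atOne-false x {i} i≢L e xi≡1 with i Fin.≟ lastI d | x i ≟ 1ℚ
  ... | yes i≡L | _       = i≢L i≡L
  ... | no _    | yes _   = true≢false e
  ... | no _    | no xi≢1 = xi≢1 xi≡1

  atOne-off : ∀ x {i} → i ≢ lastI d → atOne x i ≡ does (x i ≟ 1ℚ)
  atOne-off x i≢L = cong (λ c → not c ∧ _) (does-≢ i≢L)

  atOne-L : ∀ x → atOne x (lastI d) ≡ false
  atOne-L x = cong (λ c → not c ∧ does (x (lastI d) ≟ 1ℚ)) (does-refl (lastI d))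

  ones : Vecℚ (suc (suc d)) → ℕ
  ones x = count (atOne x)

  ones-∅ : ones (point (λ _ → false)) ≡ 0
  ones-∅ = count-none _ (λ i → none i (i Fin.≟ lastI d))
    where
    none : ∀ i → Dec (i ≡ lastI d) → atOne (point (λ _ → false)) i ≡ false
    none i (yes refl) = atOne-L (point (λ _ → false))
    none i (no i≢L)   =
      trans (atOne-off (point (λ _ → false)) i≢L) (cong (λ q → does (q ≟ 1ℚ)) (point-off (λ _ → false) i≢L))

  ones-first : ones (point first) ≡ suc d
  ones-first = trans (count-cong (λ i → all-but-L i (i Fin.≟ lastI d))) (count-all-but-last (suc d))
    where
    all-but-L : ∀ i → Dec (i ≡ lastI d) → atOne (point first) i ≡ not (does (i Fin.≟ lastI d))
    all-but-L i (yes refl) = trans (atOne-L (point first)) (cong not (sym (does-refl i)))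
    all-but-L i (no i≢L)   = trans (atOne-off (point first) i≢L)
      (trans (cong (λ q → does (q ≟ 1ℚ)) (trans (point-off first i≢L) (cong bit (first-off-L i≢L))))
             (cong not (sym (does-≢ i≢L))))

  point-first-P : point first P ≡ 1ℚ
  point-first-P = trans (point-off first P≢L) (cong bit (first-P {d}))

  point-∅-P : point (λ _ → false) P ≡ 0ℚ
  point-∅-P = point-off (λ _ → false) P≢L

  module _ (0<Σb : 0 ℕ.< sumℕ b) (0<b : ∀ j → 0 ℕ.< b j) where

    open Nondegenerate (w≢0 0<Σb 0<b) not-tight-01

    ones-step : ∀ {u v} → Edge u v → ones v ℕ.≤ suc (ones u)
    ones-step {u} {v} uv = count-≤-suc (atOne u) (atOne v) two-raised
      where
      two-raised : ∀ i j → i ≢ j → atOne v i ≡ true → atOne u i ≡ false → atOne v j ≡ true → atOne u j ≡ false → ⊥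
      two-raised i j i≢j vi ui vj uj =
        at-most-one-raised uv i≢j (proj₂ (atOne-true v vi)) (atOne-false u (proj₁ (atOne-true v vi)) ui)
                                  (proj₂ (atOne-true v vj)) (atOne-false u (proj₁ (atOne-true v vj)) uj)

    ones-walk : ∀ {u z k} → Walk b u z k → ones z ℕ.≤ ones u ℕ.+ k
    ones-walk {u} here = ℕₚ.m≤m+n (ones u) 0
    ones-walk {u} {k = suc k} (step uv walk) =
      ℕₚ.≤-trans (ones-walk walk) (ℕₚ.≤-trans (ℕₚ.+-monoˡ-≤ k (ones-step uv)) (ℕₚ.≤-reflexive (sym (ℕₚ.+-suc (ones u) k))))

    -- A walk of length at most d + 1 from ∅ to first must raise one coordinate per step,
    -- so it stays among almost-integral points until the step that raises P.
    short-walk-crosses : ∀ {u k} → AlmostIntegral (lastI d) u → u P ≡ 0ℚ → ones u ℕ.+ k ℕ.≤ suc d →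
                         Walk b u (point first) k → ∃ λ (S : Subset d) → sumIn b S ≡ sumOut b S
    short-walk-crosses u-almost uP≡0 budget here = ⊥-elim (<⇒≢ 0<1 (trans (sym uP≡0) point-first-P))
    short-walk-crosses {u} {suc k} u-almost uP≡0 budget (step {y = v} uv walk) = by-raised (l Fin.≟ P)
      where
      ones-u<ones-v : ones u ℕ.< ones v
      ones-u<ones-v = ℕₚ.+-cancelʳ-≤ k (suc (ones u)) (ones v)
        (ℕₚ.≤-trans (ℕₚ.≤-reflexive (sym (ℕₚ.+-suc (ones u) k)))
          (ℕₚ.≤-trans budget (ℕₚ.≤-trans (ℕₚ.≤-reflexive (sym ones-first)) (ones-walk walk))))
      new = count-<⇒new (atOne u) (atOne v) ones-u<ones-v
      l = proj₁ new
      l≢L = proj₁ (atOne-true v (proj₁ (proj₂ new)))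
      vl≡1 = proj₂ (atOne-true v (proj₁ (proj₂ new)))
      moved = almost-integral-step uv u-almost l≢L vl≡1 (atOne-false u l≢L (proj₂ (proj₂ new)))
      by-raised : Dec (l ≡ P) → ∃ λ (S : Subset d) → sumIn b S ≡ sumOut b S
      by-raised (yes l≡P) =
        crossing-balanced u-almost (proj₁ moved) uP≡0 (subst (λ i → v i ≡ 1ℚ) l≡P vl≡1)
          (λ j → proj₂ moved (item j) (λ e → item≢P j (trans e l≡P)) (item≢L j))
      by-raised (no l≢P) =
        short-walk-crosses (proj₁ moved) (trans (proj₂ moved P (l≢P ∘′ sym) P≢L) uP≡0)
          (ℕₚ.≤-trans (ℕₚ.+-monoˡ-≤ k (ones-step uv)) (ℕₚ.≤-trans (ℕₚ.≤-reflexive (sym (ℕₚ.+-suc (ones u) k))) budget))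
          walk

walk⇒balanced : ∀ {d} (b : Fin d → ℕ) → (∀ j → 0 ℕ.< b j) →
                DistLe b (point b (λ _ → false)) (point b first) (suc d) → ∃ λ (S : Subset d) → sumIn b S ≡ sumOut b S
walk⇒balanced {zero}  b 0<b _                 = [] , refl
walk⇒balanced {suc d} b 0<b (k , k≤2+d , walk) =
  short-walk-crosses b 0<Σb 0<b (point-almost-integral b {λ _ → false} (∅-admissible b)) (point-∅-P b)
    (subst (λ n → n ℕ.+ k ℕ.≤ suc (suc d)) (sym (ones-∅ b)) k≤2+d) walk
  where 0<Σb = ℕₚ.<-≤-trans (0<b Fin.zero) (ℕₚ.m≤m+n (b Fin.zero) _)

lemma2p4 : (d : ℕ) (b : Fin d → ℕ) → (∀ i → 0 ℕ.< b i) → 2 ∣ sumℕ b →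
    (IsVertex b (pt b ∅S (lastI d)) × IsVertex b (pt b (firstS d) (lastI d)))
    × (DistLe b (pt b ∅S (lastI d)) (pt b (firstS d) (lastI d)) (suc d)
    ⇔ ∃ (λ (S : Subset d) → sumIn b S ≡ sumOut b S))
lemma2p4 d b 0<b _ =
  (point-vertex b {λ _ → false} (∅-admissible b) , point-vertex b {first} (first-admissible b)) ,
  mk⇔ (walk⇒balanced b 0<b) (λ { (S , balanced) → balanced⇒walk b S balanced })
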